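{- For any $i \ge 0$, a lower bound on $M(i)$ is the Catalan number $C_{i+1}$ (where $C_1 = 1, C_2 = 2, C_3 = 5$).
   Context: For a connected Grassmann necklace $\mathcal{I}$ of $k$-subsets of $[n]$, the exchange graph $\mathcal{G}^{\mathcal{I}}$ has as vertices the maximal weakly separated collections over $\mathcal{I}$, with edges given by single mutations; its interior size is $|\mathcal{V}|-|\mathcal{I}|$ for any vertex $\mathcal{V}$. $M(i)$ denotes the maximum possible order (number of vertices) of an exchange graph with interior size $i$. -}

module Defs where

open import Data.Nat using (ℕ; zero; suc; _+_; _*_; _≤_; _<_; NonZero)
open import Data.Nat.DivMod using (_mod_; _/_)
open import Data.Nat.Combinatorics using (_C_)
open import Data.Bool using (Bool; true; false)
open import Data.Bool.Properties using () renaming (_≟_ to _≟B_)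
open import Data.Fin as Fin using (Fin; toℕ)
open import Data.Fin.Subset using (Subset; _∈_; _∉_; _∩_; _∪_; _-_; ⁅_⁆; ∣_∣; ⊤; Nonempty; ∁)
open import Data.Fin.Subset.Properties using (_∈?_)
open import Data.Vec using (Vec; []; _∷_)
open import Data.Vec.Properties using (≡-dec)
open import Data.List using (List; []; _∷_; _++_; map; filter; upTo; length; allFin)
open import Data.Bool.ListAction using (any)
open import Data.List.Relation.Binary.Pointwise using (Pointwise)
open import Data.List.Relation.Unary.AllPairs using (AllPairs)
open import Data.List.Relation.Unary.All using (All)
open import Data.Product using (Σ; ∃; ∃-syntax; _×_; _,_)
open import Data.Sum using (_⊎_)
open import Relation.Nullary using (¬_; does)
open import Relation.Binary.PropositionalEquality using (_≡_; _≢_)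

catalan : ℕ → ℕ
catalan m = ((2 * m) C m) / suc m

-- Ground set [n] is modelled by Fin n (element j ∈ Fin n stands for j+1);
-- subsets of [n] are Data.Fin.Subset.

_≟S_ : ∀ {n} (S T : Subset n) → Relation.Nullary.Dec (S ≡ T)
_≟S_ = ≡-dec _≟B_

allSubsets : ∀ n → List (Subset n)
allSubsets zero    = [] ∷ []
allSubsets (suc n) = map (true ∷_) (allSubsets n) ++ map (false ∷_) (allSubsets n)

nextFin : ∀ {n} → Fin n → Fin n
nextFin {suc m} j = suc (toℕ j) mod suc m

-- Weak separation (for k-subsets): I, J are weakly separated iff there are
-- no cyclically ordered a < b < c < d with a, c ∈ I ∖ J and b, d ∈ J ∖ I.
-- (A cyclic rotation of a<b<c<d alternating between X=I∖J and Y=J∖I is,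
-- linearly, either X Y X Y or Y X Y X.)

_∖∋_ : ∀ {n} → Subset n × Subset n → Fin n → Set
(I , J) ∖∋ x = x ∈ I × x ∉ J

Alternating : ∀ {n} → (Fin n → Set) → (Fin n → Set) → Set
Alternating {n} X Y =
  ∃[ a ] ∃[ b ] ∃[ c ] ∃[ d ]
    (a Fin.< b × b Fin.< c × c Fin.< d × X a × Y b × X c × Y d)

WeaklySeparated : ∀ {n} → Subset n → Subset n → Set
WeaklySeparated I J =
  ¬ (Alternating ((I , J) ∖∋_) ((J , I) ∖∋_)
     ⊎ Alternating ((J , I) ∖∋_) ((I , J) ∖∋_))

record GrassmannNecklace (n k : ℕ) : Set where
  field
    I      : Fin n → Subset n
    size   : ∀ j → ∣ I j ∣ ≡ k
    step∈  : ∀ j → j ∈ I j → ∃[ x ] (I (nextFin j) ≡ ((I j - j) ∪ ⁅ x ⁆))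
    step∉  : ∀ j → j ∉ I j → I (nextFin j) ≡ I j

-- Shifted linear order  i <_i i+1 <_i ... <_i i-1  and Gale order.
-- shiftedKeys i J lists the elements of J, sorted increasingly w.r.t. <_i,
-- each replaced by its position r ∈ {0,…,n-1} in the order <_i
-- (element (i + r) mod n has position r); this is an order isomorphism.

shiftedKeys : ∀ {n} → Fin n → Subset n → List ℕ
shiftedKeys {suc m} i J =
  filter (λ r → ((toℕ i + r) mod suc m) ∈? J) (upTo (suc m))

GaleLeq : ∀ {n} → Fin n → Subset n → Subset n → Set
GaleLeq i I J = Pointwise _≤_ (shiftedKeys i I) (shiftedKeys i J)

module _ {n k : ℕ} (𝓘 : GrassmannNecklace n k) where
  open GrassmannNecklace 𝓘

  InPositroid : Subset n → Set
  InPositroid J = ∣ J ∣ ≡ k × (∀ i → GaleLeq i (I i) J)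

  IsRank : Subset n → ℕ → Set
  IsRank S r = (∃[ B ] (InPositroid B × ∣ B ∩ S ∣ ≡ r))
             × (∀ B → InPositroid B → ∣ B ∩ S ∣ ≤ r)

  Separator : Subset n → Set
  Separator S = Nonempty S × Nonempty (∁ S)
              × ∃[ r₁ ] ∃[ r₂ ] ∃[ r ]
                  (IsRank S r₁ × IsRank (∁ S) r₂ × IsRank ⊤ r × r₁ + r₂ ≡ r)

  Connected : Set
  Connected = ¬ (∃[ S ] Separator S)

  Collection : Set
  Collection = Subset n → Bool

  IsMaxWSC : Collection → Set
  IsMaxWSC V =
      (∀ S → V S ≡ true → InPositroid S)
    × (∀ j → V (I j) ≡ true)
    × (∀ S T → V S ≡ true → V T ≡ true → WeaklySeparated S T)
    × (∀ T → InPositroid T → (∀ S → V S ≡ true → WeaklySeparated S T) → V T ≡ true)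

  card : Collection → ℕ
  card V = length (filter (λ S → V S ≟B true) (allSubsets n))

  necklaceCard : ℕ
  necklaceCard =
    length (filter (λ S → any (λ j → does (I j ≟S S)) (allFin n) ≟B true) (allSubsets n))

  HasInteriorSize : ℕ → Set
  HasInteriorSize i = ∀ V → IsMaxWSC V → card V ≡ necklaceCard + i

  OrderAtLeast : ℕ → Set
  OrderAtLeast m =
    ∃[ Vs ] (length Vs ≡ m × All IsMaxWSC Vs
             × AllPairs (λ V W → ∃[ S ] (V S ≢ W S)) Vs)

-- "M(i) ≥ m": some exchange graph of a connected Grassmann necklace with
-- interior size i has at least m vertices.

MLowerBound : ℕ → ℕ → Set
MLowerBound i m =
  ∃[ n ] ∃[ k ] Σ (GrassmannNecklace n k) λ 𝓘 →
    Connected 𝓘 × HasInteriorSize 𝓘 i × OrderAtLeast 𝓘 m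

-- Take the necklace of sides I_j = {j, j + 1} of the n-gon, n = i + 3, with k = 2. Its positroid
-- is the uniform matroid of rank 2 on [n], which is connected, and two 2-subsets are weakly
-- separated exactly when the chords they span do not cross. So the maximal weakly separated
-- collections are the triangulations of the n-gon, sides included. Splitting a triangulation at
-- the triangle on the chord {0, n − 1} shows by induction that it has 2n − 3 chords, n of which
-- are sides: the interior size is n − 3 = i. Binary trees with n − 1 leaves give pairwise distinct
-- triangulations, and counting them by ballot numbers yields C_{n−2} = C_{i+1} of them.

module Submission where

open import Defs
open import Data.Bool using (Bool; true; false; _∧_; _∨_)
open import Data.Bool.ListAction using (any)
open import Data.Bool.Properties using (¬-not; ∨-comm; ∨-zeroʳ; ∨-identityʳ; T-≡) renaming (_≟_ to _≟ᵇ_)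
open import Data.Empty using (⊥; ⊥-elim)
open import Data.Fin as Fin using (Fin; toℕ; fromℕ<)
open import Data.Fin.Properties using (toℕ<n; toℕ-fromℕ<; toℕ-injective)
open import Data.Fin.Subset using (Subset; _∈_; _∉_; _─_; _∪_; _∩_; _-_; ⁅_⁆; ∣_∣; ⊤)
open import Data.Fin.Subset.Properties
  using (_∈?_; ⊆-antisym; x∈p∪q⁺; x∈p∪q⁻; x∈p∧x∉q⇒x∈p─q; p─q⊆p; x∈⁅x⁆; x∈⁅y⁆⇒x≡y; ∣⁅x⁆∣≡1;
         p⊆q⇒∣p∣≤∣q∣; x∈p∩q⁺; ∩-identityʳ; x∈∁p⇒x∉p; x∉p⇒x∈∁p)
open import Data.List using (List; []; _∷_; _++_; map; filter; length; upTo; allFin)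
open import Data.List.Membership.Propositional using () renaming (_∈_ to _∈ˡ_)
open import Data.List.Membership.Propositional.Properties using (∈-allFin; ∈-map⁻)
open import Data.List.Properties
  using (length-map; length-++; filter-++; filter-accept; filter-reject; upTo-∷ʳ; ++-identityʳ)
open import Data.List.Relation.Binary.Pointwise using ([]; _∷_)
open import Data.List.Relation.Unary.All as All using (All; []; _∷_)
import Data.List.Relation.Unary.All.Properties as All
open import Data.List.Relation.Unary.AllPairs using (AllPairs; []; _∷_)
open import Data.List.Relation.Unary.Any using (here; there)
open import Data.List.Relation.Unary.Unique.Propositional using (Unique)
import Data.List.Relation.Unary.Unique.Propositional.Properties as Unique
open import Data.Nat
open import Data.Nat.Combinatorics using (_C_; nCk≡nC[n∸k]; nC1≡n; nCk+nC[k+1]≡[n+1]C[k+1])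
open import Data.Nat.DivMod using (_%_; _/_; _mod_; m<n⇒m%n≡m; [m+n]%n≡m%n; m%n<n; n%n≡0; m*n/n≡m)
open import Data.Nat.Induction using (<-rec)
open import Data.Nat.Properties
open import Data.Nat.Tactic.RingSolver using (solve-∀)
open import Data.Product using (∃; _×_; _,_; proj₁; proj₂)
open import Data.Sum using (_⊎_; inj₁; inj₂; swap)
open import Data.Vec using (Vec; []; _∷_; here; there; replicate; head)
open import Function using (_∘_)
open import Function.Bundles using (Equivalence)
open import Level using (0ℓ)
open import Relation.Binary.Definitions using (tri<; tri≈; tri>)
open import Relation.Binary.PropositionalEquality
open import Relation.Nullary using (¬_; Dec; does; yes; no)
open import Relation.Nullary.Decidable using (dec-true)
open import Relation.Unary using (Pred; Decidable)

≡true⇒≢false : ∀ {b} → b ≡ true → b ≢ false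
≡true⇒≢false refl ()

∨-≡trueˡ : ∀ {a} b → a ≡ true → a ∨ b ≡ true
∨-≡trueˡ b refl = refl

∨-≡trueʳ : ∀ a {b} → b ≡ true → a ∨ b ≡ true
∨-≡trueʳ a refl = ∨-zeroʳ a

∨-≡true⁻ : ∀ a {b} → a ∨ b ≡ true → a ≡ true ⊎ b ≡ true
∨-≡true⁻ true  _  = inj₁ refl
∨-≡true⁻ false eq = inj₂ eq

∧-≡true⁻ : ∀ a {b} → a ∧ b ≡ true → a ≡ true × b ≡ true
∧-≡true⁻ true eq = refl , eq

≡ᵇ-≡true⇒≡ : ∀ m n → (m ≡ᵇ n) ≡ true → m ≡ n
≡ᵇ-≡true⇒≡ m n eq = ≡ᵇ⇒≡ m n (Equivalence.from T-≡ eq)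

≡⇒≡ᵇ-≡true : ∀ m n → m ≡ n → (m ≡ᵇ n) ≡ true
≡⇒≡ᵇ-≡true m n eq = Equivalence.to T-≡ (≡⇒≡ᵇ m n eq)

any-≡true⁻ : ∀ {A : Set} (p : A → Bool) xs → any p xs ≡ true → ∃ λ x → p x ≡ true
any-≡true⁻ p (x ∷ xs) eq with ∨-≡true⁻ (p x) eq
... | inj₁ px  = x , px
... | inj₂ pxs = any-≡true⁻ p xs pxs

any-≡true⁺ : ∀ {A : Set} (p : A → Bool) {x} xs → x ∈ˡ xs → p x ≡ true → any p xs ≡ true
any-≡true⁺ p (y ∷ xs) (here refl) px = ∨-≡trueˡ _ px
any-≡true⁺ p (y ∷ xs) (there x∈)  px = ∨-≡trueʳ (p y) (any-≡true⁺ p xs x∈ px)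

does-≡true⁻ : ∀ {P : Set} (P? : Dec P) → does P? ≡ true → P
does-≡true⁻ (yes p) _ = p

≡true⇔⇒≡ : ∀ {a b} → (a ≡ true → b ≡ true) → (b ≡ true → a ≡ true) → a ≡ b
≡true⇔⇒≡ {true}  a⇒b _ = sym (a⇒b refl)
≡true⇔⇒≡ {false} {true}  _ b⇒a = b⇒a refl
≡true⇔⇒≡ {false} {false} _ _   = refl

allPairs-map : ∀ {A B : Set} {P : A → Set} {R : A → A → Set} {S : B → B → Set} (f : A → B) →
  (∀ {x y} → P x → P y → R x y → S (f x) (f y)) → ∀ {xs} → All P xs → AllPairs R xs → AllPairs S (map f xs)
allPairs-map f g []         []         = []
allPairs-map f g (px ∷ pxs) (rx ∷ rxs) =
  All.map⁺ (All.zipWith (λ (py , r) → g px py r) (pxs , rx)) ∷ allPairs-map f g pxs rxs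

bit : Bool → ℕ
bit true  = 1
bit false = 0

count : (ℕ → Bool) → ℕ → ℕ
count f zero    = 0
count f (suc n) = bit (f 0) + count (f ∘ suc) n

count-cong : ∀ n {f g} → (∀ j → j < n → f j ≡ g j) → count f n ≡ count g n
count-cong zero    eq = refl
count-cong (suc n) eq =
  cong₂ _+_ (cong bit (eq 0 z<s)) (count-cong n (λ j j<n → eq (suc j) (s<s j<n)))

count-+ : ∀ a b f → count f (a + b) ≡ count f a + count (λ j → f (a + j)) b
count-+ zero    b f = refl
count-+ (suc a) b f =
  trans (cong (bit (f 0) +_) (count-+ a b (f ∘ suc))) (sym (+-assoc (bit (f 0)) _ _))

count-none : ∀ n f → (∀ j → j < n → f j ≡ false) → count f n ≡ 0
count-none zero    f none = refl
count-none (suc n) f none rewrite none 0 z<s =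
  count-none n (f ∘ suc) (λ j j<n → none (suc j) (s<s j<n))

count-onlyLast : ∀ q f → f q ≡ true → (∀ j → j < q → f j ≡ false) → count f (suc q) ≡ 1
count-onlyLast zero    f fq none rewrite fq = refl
count-onlyLast (suc q) f fq none rewrite none 0 z<s =
  count-onlyLast q (f ∘ suc) fq (λ j j<q → none (suc j) (s<s j<q))

-- Chords of a convex polygon

-- E x y, for x < y, tells whether the chord between the vertices x and y is present.
Chords : Set
Chords = ℕ → ℕ → Bool

shift : ℕ → Chords → Chords
shift p E x y = E (p + x) (p + y)

countChords : Chords → ℕ → ℕ
countChords E zero    = 0
countChords E (suc n) = count (E 0 ∘ suc) n + countChords (shift 1 E) n

-- the number of chords x < p < y ≤ p + q
countAcross : Chords → ℕ → ℕ → ℕ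
countAcross E zero    q = 0
countAcross E (suc p) q = count (λ j → E 0 (2 + p + j)) q + countAcross (shift 1 E) p q

countChords-cong : ∀ n {E F} → (∀ x y → x < y → y < n → E x y ≡ F x y) →
                   countChords E n ≡ countChords F n
countChords-cong zero    eq = refl
countChords-cong (suc n) eq =
  cong₂ _+_ (count-cong n (λ j j<n → eq 0 (suc j) z<s (s<s j<n)))
            (countChords-cong n (λ x y x<y y<n → eq (suc x) (suc y) (s<s x<y) (s<s y<n)))

countChords-split : ∀ p q E →
  countChords E (suc (p + q)) ≡ countChords E (suc p) + countChords (shift p E) (suc q) + countAcross E p q
countChords-split zero    q E = sym (+-identityʳ _)
countChords-split (suc p) q E = begin
  count f (suc p + q) + countChords (shift 1 E) (suc (p + q))
    ≡⟨ cong₂ _+_ (count-+ (suc p) q f) (countChords-split p q (shift 1 E)) ⟩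
  (count f (suc p) + count (λ j → f (suc p + j)) q)
    + (countChords (shift 1 E) (suc p) + countChords (shift p (shift 1 E)) (suc q) + countAcross (shift 1 E) p q)
    ≡⟨ regroup (count f (suc p)) _ _ _ _ ⟩
  countChords E (suc (suc p)) + countChords (shift (suc p) E) (suc q) + countAcross E (suc p) q ∎
  where
  open ≡-Reasoning
  f : ℕ → Bool
  f = E 0 ∘ suc
  regroup : ∀ a b c d e → (a + b) + (c + d + e) ≡ (a + c) + d + (b + e)
  regroup = solve-∀

countAcross-none : ∀ p q E → (∀ x j → x < p → j < q → E x (suc (p + j)) ≡ false) →
                   countAcross E p q ≡ 0
countAcross-none zero    q E none = refl
countAcross-none (suc p) q E none =
  cong₂ _+_ (count-none q _ (λ j j<q → none 0 j z<s j<q))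
            (countAcross-none p q (shift 1 E) (λ x j x<p j<q → none (suc x) j (s<s x<p) j<q))

countAcross-onlyOuter : ∀ p q E → E 0 (suc (suc p + q)) ≡ true →
  (∀ j → j < q → E 0 (suc (suc p + j)) ≡ false) →
  (∀ x j → x < p → j < suc q → E (suc x) (suc (suc p + j)) ≡ false) →
  countAcross E (suc p) (suc q) ≡ 1
countAcross-onlyOuter p q E outer fromZero fromOthers =
  cong₂ _+_ (count-onlyLast q _ outer fromZero) (countAcross-none p (suc q) (shift 1 E) fromOthers)

-- The chords {x, y} and {x', y'} cross, and x is the smallest of the four endpoints.
Crossing : ℕ → ℕ → ℕ → ℕ → Set
Crossing x y x' y' = x < x' × x' < y × y < y'

NonCrossing : Chords → ℕ → Set
NonCrossing E L =
  ∀ x y x' y' → y ≤ L → y' ≤ L → E x y ≡ true → E x' y' ≡ true → ¬ Crossing x y x' y'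

CrossesNone : Chords → ℕ → ℕ → ℕ → Set
CrossesNone E L x y =
  ∀ x' y' → x' < y' → y' ≤ L → E x' y' ≡ true → ¬ Crossing x y x' y' × ¬ Crossing x' y' x y

Maximal : Chords → ℕ → Set
Maximal E L = ∀ x y → x < y → y ≤ L → CrossesNone E L x y → E x y ≡ true

NonCrossing-≤ : ∀ {E L c} → c ≤ L → NonCrossing E L → NonCrossing E c
NonCrossing-≤ c≤L nc x y x' y' y≤c y'≤c = nc x y x' y' (≤-trans y≤c c≤L) (≤-trans y'≤c c≤L)

NonCrossing-shift : ∀ {E} c q → NonCrossing E (c + q) → NonCrossing (shift c E) q
NonCrossing-shift c q nc x y x' y' y≤q y'≤q e e' (x<x' , x'<y , y<y') =
  nc (c + x) (c + y) (c + x') (c + y') (+-monoʳ-≤ c y≤q) (+-monoʳ-≤ c y'≤q) e e'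
     (+-monoʳ-< c x<x' , +-monoʳ-< c x'<y , +-monoʳ-< c y<y')

-- The chord (0, c) cuts off the polygon 0 … c, which inherits maximality.
Maximal-≤ : ∀ {E L c} → c ≤ L → NonCrossing E L → E 0 c ≡ true → Maximal E L → Maximal E c
Maximal-≤ {E} {L} {c} c≤L nc 0c mx x y x<y y≤c none =
  mx x y x<y (≤-trans y≤c c≤L) crossesNone
  where
  crossesNone : CrossesNone E L x y
  crossesNone x' y' x'<y' y'≤L e with y' ≤? c
  ... | yes y'≤c = none x' y' x'<y' y'≤c e
  ... | no  y'≰c =
    (λ (x<x' , x'<y , _) → nc 0 c x' y' c≤L y'≤L 0c e
                             (≤-trans z<s x<x' , <-≤-trans x'<y y≤c , ≰⇒> y'≰c)) ,
    (λ (_ , _ , y'<y) → y'≰c (≤-trans (<⇒≤ y'<y) y≤c))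

-- Likewise the chord (c, c + q) cuts off the polygon c … c + q.
Maximal-shift : ∀ {E} c q → NonCrossing E (c + q) → E c (c + q) ≡ true →
                Maximal E (c + q) → Maximal (shift c E) q
Maximal-shift {E} c q nc cL mx x y x<y y≤q none =
  mx (c + x) (c + y) (+-monoʳ-< c x<y) (+-monoʳ-≤ c y≤q) crossesNone
  where
  cancel : ∀ {a b} → c + a < c + b → a < b
  cancel = +-cancelˡ-< c _ _
  crossesNone : CrossesNone E (c + q) (c + x) (c + y)
  crossesNone x' y' x'<y' y'≤L e with c ≤? x'
  ... | no c≰x' =
    (λ (cx<x' , _ , _) → c≰x' (≤-trans (m≤m+n c x) (<⇒≤ cx<x'))) ,
    (λ (x'<cx , cx<y' , y'<cy) →
       nc x' y' c (c + q) y'≤L ≤-refl e cL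
          (≰⇒> c≰x' , ≤-<-trans (m≤m+n c x) cx<y' , <-≤-trans y'<cy (+-monoʳ-≤ c y≤q)))
  ... | yes c≤x' with m≤n⇒∃[o]m+o≡n c≤x'
  ...   | a , refl with m≤n⇒∃[o]m+o≡n (≤-trans (m≤m+n c a) (<⇒≤ x'<y'))
  ...     | b , refl =
    let (n₁ , n₂) = none a b (cancel x'<y') (+-cancelˡ-≤ c _ _ y'≤L) e in
    (λ (u , v , w) → n₁ (cancel u , cancel v , cancel w)) ,
    (λ (u , v , w) → n₂ (cancel u , cancel v , cancel w))

Maximal-outer : ∀ {E L} → 1 ≤ L → Maximal E L → E 0 L ≡ true
Maximal-outer {L = L} 1≤L mx =
  mx 0 L 1≤L ≤-refl (λ x' y' _ y'≤L _ → (λ (_ , _ , L<y') → <⇒≱ L<y' y'≤L) , λ ())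

Maximal-firstSide : ∀ {E L} → 1 ≤ L → Maximal E L → E 0 1 ≡ true
Maximal-firstSide 1≤L mx =
  mx 0 1 z<s 1≤L (λ x' y' _ _ _ → (λ { (s<s _ , s<s () , _) }) , λ ())

LastBelow : (ℕ → Bool) → ℕ → Set
LastBelow f L = ∃ λ c → 1 ≤ c × c < L × f c ≡ true × (∀ y → c < y → y < L → f y ≡ false)

lastBelow : ∀ f L → f 1 ≡ true → 1 < L → LastBelow f L
lastBelow f (suc L) f1 (s<s 1≤L) with f L in fL
... | true = L , 1≤L , n<1+n L , fL , λ y L<y y<1+L → ⊥-elim (<⇒≱ L<y (≤-pred y<1+L))
... | false with m≤n⇒m<n∨m≡n 1≤L
...   | inj₂ refl = ⊥-elim (≡true⇒≢false f1 fL)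
...   | inj₁ 1<L with lastBelow f L f1 1<L
...     | c , 1≤c , c<L , fc , after = c , 1≤c , m<n⇒m<1+n c<L , fc , after′
  where
  after′ : ∀ y → c < y → y < suc L → f y ≡ false
  after′ y c<y y<1+L with m≤n⇒m<n∨m≡n (≤-pred y<1+L)
  ... | inj₁ y<L  = after y c<y y<L
  ... | inj₂ refl = fL

TriangulationSize : ℕ → Set
TriangulationSize L =
  1 ≤ L → ∀ E → NonCrossing E L → Maximal E L → countChords E (suc L) + 1 ≡ 2 * L

-- c is the apex of the triangle on the outer chord (0, c + q).
module Apex {E : Chords} (c' q' : ℕ) where
  c q : ℕ
  c = suc c'
  q = suc q'

  module _ (nc : NonCrossing E (c + q)) (0c : E 0 c ≡ true)
           (last : ∀ y → c < y → y < c + q → E 0 y ≡ false) where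

    apex-outer : Maximal E (c + q) → E c (c + q) ≡ true
    apex-outer mx = mx c (c + q) (m<m+n c z<s) ≤-refl crossesNone
      where
      crossesNone : CrossesNone E (c + q) c (c + q)
      crossesNone zero     y' _ y'≤L e = (λ (_ , _ , L<y') → <⇒≱ L<y' y'≤L) ,
        λ (_ , c<y' , y'<L) → ≡true⇒≢false e (last y' c<y' y'<L)
      crossesNone (suc x') y' _ y'≤L e = (λ (_ , _ , L<y') → <⇒≱ L<y' y'≤L) ,
        λ (x'<c , c<y' , _) → nc 0 c (suc x') y' (m≤m+n c q) y'≤L 0c e (z<s , x'<c , c<y')

    countAcross-apex : Maximal E (c + q) → countAcross E c q ≡ 1
    countAcross-apex mx = countAcross-onlyOuter c' q' E outer fromZero fromOthers
      where
      L≡ : c + q ≡ suc (suc c' + q')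
      L≡ = cong suc (+-suc c' q')
      outer : E 0 (suc (suc c' + q')) ≡ true
      outer = subst (λ y → E 0 y ≡ true) L≡ (Maximal-outer z<s mx)
      c<2+c'+j : ∀ j → c < suc (suc c' + j)
      c<2+c'+j j = s<s (s≤s (m≤m+n c' j))
      2+c'+j≤L : ∀ j → j ≤ q' → suc (suc c' + j) ≤ c + q
      2+c'+j≤L j j≤q' = subst (suc (suc c' + j) ≤_) (sym L≡) (s≤s (s≤s (+-monoʳ-≤ c' j≤q')))
      fromZero : ∀ j → j < q' → E 0 (suc (suc c' + j)) ≡ false
      fromZero j j<q' =
        last _ (c<2+c'+j j) (subst (suc (suc c' + j) <_) (sym L≡) (s<s (s<s (+-monoʳ-< c' j<q'))))
      fromOthers : ∀ x j → x < c' → j < q → E (suc x) (suc (suc c' + j)) ≡ false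
      fromOthers x j x<c' j<q = ¬-not λ e →
        nc 0 c (suc x) _ (m≤m+n c q) (2+c'+j≤L j (≤-pred j<q)) 0c e (z<s , s<s x<c' , c<2+c'+j j)

    countChords-apex : Maximal E (c + q) → (∀ {L'} → L' < c + q → TriangulationSize L') →
                       countChords E (suc (c + q)) + 1 ≡ 2 * (c + q)
    countChords-apex mx rec = begin
      countChords E (suc (c + q)) + 1
        ≡⟨ cong (_+ 1) (countChords-split c q E) ⟩
      countChords E (suc c) + countChords (shift c E) (suc q) + countAcross E c q + 1
        ≡⟨ cong (λ a → countChords E (suc c) + countChords (shift c E) (suc q) + a + 1) (countAcross-apex mx) ⟩
      countChords E (suc c) + countChords (shift c E) (suc q) + 1 + 1
        ≡⟨ add-halves left right ⟩
      2 * (c + q) ∎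
      where
      open ≡-Reasoning
      c≤L : c ≤ c + q
      c≤L = m≤m+n c q
      cL : E c (c + q) ≡ true
      cL = apex-outer mx
      left : countChords E (suc c) + 1 ≡ 2 * c
      left = rec (m<m+n c z<s) z<s E (NonCrossing-≤ c≤L nc) (Maximal-≤ c≤L nc 0c mx)
      right : countChords (shift c E) (suc q) + 1 ≡ 2 * q
      right = rec (m<n+m q z<s) z<s (shift c E) (NonCrossing-shift c q nc) (Maximal-shift c q nc cL mx)
      add-halves : ∀ {A B} → A + 1 ≡ 2 * c → B + 1 ≡ 2 * q → A + B + 1 + 1 ≡ 2 * (c + q)
      add-halves {A} {B} eqA eqB = begin
        A + B + 1 + 1        ≡⟨ regroup A B ⟩
        (A + 1) + (B + 1)    ≡⟨ cong₂ _+_ eqA eqB ⟩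
        2 * c + 2 * q        ≡⟨ *-distribˡ-+ 2 c q ⟨
        2 * (c + q)          ∎
        where
        regroup : ∀ A B → A + B + 1 + 1 ≡ (A + 1) + (B + 1)
        regroup = solve-∀

countChords-maximal : ∀ L → TriangulationSize L
countChords-maximal = <-rec TriangulationSize step
  where
  step : ∀ L → (∀ {L'} → L' < L → TriangulationSize L') → TriangulationSize L
  step L rec 1≤L E nc mx with m≤n⇒m<n∨m≡n 1≤L
  ... | inj₂ refl rewrite Maximal-firstSide 1≤L mx = refl
  ... | inj₁ 1<L with lastBelow (E 0) L (Maximal-firstSide 1≤L mx) 1<L
  ...   | suc c' , _ , c<L , 0c , last with m≤n⇒∃[o]m+o≡n (<⇒≤ c<L)
  ...     | zero    , refl = ⊥-elim (<-irrefl (sym (+-identityʳ (suc c'))) c<L)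
  ...     | suc q'  , refl = Apex.countChords-apex c' q' nc 0c last mx rec

-- Binary trees and triangulations

data Tree : Set where
  leaf : Tree
  node : Tree → Tree → Tree

leaves : Tree → ℕ
leaves leaf       = 1
leaves (node l r) = leaves l + leaves r

1≤leaves : ∀ t → 1 ≤ leaves t
1≤leaves leaf       = ≤-refl
1≤leaves (node l r) = ≤-trans (1≤leaves l) (m≤m+n (leaves l) (leaves r))

-- A binary tree t with its leaves along the sides of the polygon a, a + 1, …, a + leaves t
-- is dual to a triangulation of that polygon: each node contributes the chord spanning its leaves.
rootChord : Tree → ℕ → Chords
rootChord t a x y = (x ≡ᵇ a) ∧ (y ≡ᵇ a + leaves t)

triangulation : Tree → ℕ → Chords
triangulation leaf       a x y = rootChord leaf a x y
triangulation (node l r) a x y =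
  rootChord (node l r) a x y ∨ (triangulation l a x y ∨ triangulation r (a + leaves l) x y)

+-leaves : ∀ a l r → a + leaves (node l r) ≡ (a + leaves l) + leaves r
+-leaves a l r = sym (+-assoc a (leaves l) (leaves r))

rootChord-self : ∀ t a → rootChord t a a (a + leaves t) ≡ true
rootChord-self t a rewrite ≡⇒≡ᵇ-≡true a a refl | ≡⇒≡ᵇ-≡true (a + leaves t) _ refl = refl

rootChord⁻ : ∀ t a x y → rootChord t a x y ≡ true → x ≡ a × y ≡ a + leaves t
rootChord⁻ t a x y eq with ∧-≡true⁻ (x ≡ᵇ a) eq
... | ex , ey = ≡ᵇ-≡true⇒≡ x a ex , ≡ᵇ-≡true⇒≡ y _ ey

triangulation-root : ∀ t a → triangulation t a a (a + leaves t) ≡ true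
triangulation-root leaf       a = rootChord-self leaf a
triangulation-root (node l r) a = ∨-≡trueˡ _ (rootChord-self (node l r) a)

triangulation-left : ∀ l r a x y → triangulation l a x y ≡ true → triangulation (node l r) a x y ≡ true
triangulation-left l r a x y eq = ∨-≡trueʳ (rootChord (node l r) a x y) (∨-≡trueˡ _ eq)

triangulation-right : ∀ l r a x y → triangulation r (a + leaves l) x y ≡ true →
                      triangulation (node l r) a x y ≡ true
triangulation-right l r a x y eq =
  ∨-≡trueʳ (rootChord (node l r) a x y) (∨-≡trueʳ (triangulation l a x y) eq)

data NodeChord (l r : Tree) (a x y : ℕ) : Set where
  root  : x ≡ a → y ≡ a + leaves (node l r) → NodeChord l r a x y
  left  : triangulation l a x y ≡ true → NodeChord l r a x y
  right : triangulation r (a + leaves l) x y ≡ true → NodeChord l r a x y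

nodeChord : ∀ l r a x y → triangulation (node l r) a x y ≡ true → NodeChord l r a x y
nodeChord l r a x y eq with ∨-≡true⁻ (rootChord (node l r) a x y) eq
... | inj₁ eqr = let (ex , ey) = rootChord⁻ (node l r) a x y eqr in root ex ey
... | inj₂ eq′ with ∨-≡true⁻ (triangulation l a x y) eq′
...   | inj₁ eql = left eql
...   | inj₂ eqr = right eqr

triangulation-bounds : ∀ t a x y → triangulation t a x y ≡ true → a ≤ x × x < y × y ≤ a + leaves t
triangulation-bounds leaf a x y eq with rootChord⁻ leaf a x y eq
... | refl , refl = ≤-refl , m<m+n a z<s , ≤-refl
triangulation-bounds (node l r) a x y eq with nodeChord l r a x y eq
... | root refl refl = ≤-refl , m<m+n a (1≤leaves (node l r)) , ≤-refl
... | left eql =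
  let (a≤x , x<y , y≤) = triangulation-bounds l a x y eql
  in a≤x , x<y , ≤-trans y≤ (≤-trans (m≤m+n _ (leaves r)) (≤-reflexive (sym (+-leaves a l r))))
... | right eqr =
  let (a≤x , x<y , y≤) = triangulation-bounds r (a + leaves l) x y eqr
  in ≤-trans (m≤m+n a (leaves l)) a≤x , x<y , subst (y ≤_) (sym (+-leaves a l r)) y≤

triangulation-nonCrossing : ∀ t a x y x' y' → triangulation t a x y ≡ true →
                            triangulation t a x' y' ≡ true → ¬ Crossing x y x' y'
triangulation-nonCrossing leaf a x y x' y' eq eq' (_ , _ , y<y') with rootChord⁻ leaf a x y eq
... | refl , refl = <⇒≱ y<y' (proj₂ (proj₂ (triangulation-bounds leaf a x' y' eq')))
triangulation-nonCrossing (node l r) a x y x' y' eq eq' (x<x' , x'<y , y<y')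
  with nodeChord l r a x y eq | nodeChord l r a x' y' eq'
... | root refl refl | _ = <⇒≱ y<y' (proj₂ (proj₂ (triangulation-bounds (node l r) a x' y' eq')))
... | left p  | root refl refl = <⇒≱ x<x' (proj₁ (triangulation-bounds l a x y p))
... | right p | root refl refl =
  <⇒≱ x<x' (≤-trans (m≤m+n a (leaves l)) (proj₁ (triangulation-bounds r _ x y p)))
... | left p  | left p'  = triangulation-nonCrossing l a x y x' y' p p' (x<x' , x'<y , y<y')
... | right p | right p' = triangulation-nonCrossing r _ x y x' y' p p' (x<x' , x'<y , y<y')
... | left p  | right p' =
  <⇒≱ x'<y (≤-trans (proj₂ (proj₂ (triangulation-bounds l a x y p))) (proj₁ (triangulation-bounds r _ x' y' p')))
... | right p | left p' =
  let (_ , x'<y' , y'≤) = triangulation-bounds l a x' y' p'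
  in <⇒≱ (<-trans x<x' x'<y') (≤-trans y'≤ (proj₁ (triangulation-bounds r _ x y p)))

triangulation-side : ∀ t a x → a ≤ x → x < a + leaves t → triangulation t a x (suc x) ≡ true
triangulation-side leaf a x a≤x x<a+1
  with ≤-antisym a≤x (≤-pred (subst (x <_) (+-comm a 1) x<a+1))
... | refl = subst (λ z → triangulation leaf a a z ≡ true) (+-comm a 1) (triangulation-root leaf a)
triangulation-side (node l r) a x a≤x x<L with x <? a + leaves l
... | yes x<c = triangulation-left l r a x (suc x) (triangulation-side l a x a≤x x<c)
... | no  x≮c = triangulation-right l r a x (suc x)
                  (triangulation-side r (a + leaves l) x (≮⇒≥ x≮c) (subst (x <_) (+-leaves a l r) x<L))

triangulation-maximal : ∀ t a x y → a ≤ x → x < y → y ≤ a + leaves t →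
  (∀ x' y' → triangulation t a x' y' ≡ true → ¬ Crossing x y x' y' × ¬ Crossing x' y' x y) →
  triangulation t a x y ≡ true
triangulation-maximal leaf a x y a≤x x<y y≤ _
  with ≤-antisym a≤x (≤-pred (≤-trans x<y (subst (y ≤_) (+-comm a 1) y≤)))
... | refl with ≤-antisym (subst (y ≤_) (+-comm a 1) y≤) x<y
...   | refl = subst (λ z → triangulation leaf a a z ≡ true) (+-comm a 1) (triangulation-root leaf a)
triangulation-maximal (node l r) a x y a≤x x<y y≤ none with y ≤? a + leaves l
... | yes y≤c = triangulation-left l r a x y
      (triangulation-maximal l a x y a≤x x<y y≤c (λ x' y' e → none x' y' (triangulation-left l r a x' y' e)))
... | no y≰c with a + leaves l ≤? x
...   | yes c≤x = triangulation-right l r a x y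
        (triangulation-maximal r _ x y c≤x x<y (subst (y ≤_) (+-leaves a l r) y≤)
          (λ x' y' e → none x' y' (triangulation-right l r a x' y' e)))
...   | no c≰x with m≤n⇒m<n∨m≡n a≤x
...     | inj₁ a<x = ⊥-elim (proj₂ (none a (a + leaves l) (triangulation-left l r a a _ (triangulation-root l a)))
                               (a<x , ≰⇒> c≰x , ≰⇒> y≰c))
...     | inj₂ refl with m≤n⇒m<n∨m≡n y≤
...       | inj₂ refl = triangulation-root (node l r) a
...       | inj₁ y<L =
  ⊥-elim (proj₁ (none (a + leaves l) (a + leaves l + leaves r)
                      (triangulation-right l r a _ _ (triangulation-root r (a + leaves l))))
                (m<m+n a (1≤leaves l) , ≰⇒> y≰c , subst (y <_) (+-leaves a l r) y<L))

node-injective : ∀ {l r l' r'} → node l r ≡ node l' r' → l ≡ l' × r ≡ r'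
node-injective refl = refl , refl

_≟ᵀ_ : (t t' : Tree) → Dec (t ≡ t')
leaf ≟ᵀ leaf = yes refl
leaf ≟ᵀ node _ _ = no λ ()
node _ _ ≟ᵀ leaf = no λ ()
node l r ≟ᵀ node l' r' with l ≟ᵀ l' | r ≟ᵀ r'
... | yes refl | yes refl = yes refl
... | no l≢l'  | _        = no (l≢l' ∘ proj₁ ∘ node-injective)
... | yes _    | no r≢r'  = no (r≢r' ∘ proj₂ ∘ node-injective)

triangulation-inLeft : ∀ l r a x y → x < y → y ≤ a + leaves l →
                       triangulation (node l r) a x y ≡ triangulation l a x y
triangulation-inLeft l r a x y x<y y≤c =
  trans (cong₂ (λ u v → u ∨ (triangulation l a x y ∨ v)) notRoot notRight) (∨-identityʳ _)
  where
  notRoot : rootChord (node l r) a x y ≡ false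
  notRoot = ¬-not λ eq → <⇒≱ (≤-<-trans y≤c (subst (a + leaves l <_) (sym (+-leaves a l r)) (m<m+n _ (1≤leaves r))))
                             (≤-reflexive (sym (proj₂ (rootChord⁻ (node l r) a x y eq))))
  notRight : triangulation r (a + leaves l) x y ≡ false
  notRight = ¬-not λ eq → <⇒≱ (<-≤-trans x<y y≤c) (proj₁ (triangulation-bounds r _ x y eq))

triangulation-inRight : ∀ l r a x y → a + leaves l ≤ x →
                        triangulation (node l r) a x y ≡ triangulation r (a + leaves l) x y
triangulation-inRight l r a x y c≤x =
  cong₂ (λ u v → u ∨ (v ∨ triangulation r (a + leaves l) x y)) notRoot notLeft
  where
  notRoot : rootChord (node l r) a x y ≡ false
  notRoot = ¬-not λ eq → <⇒≱ (<-≤-trans (m<m+n a (1≤leaves l)) c≤x)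
                             (≤-reflexive (proj₁ (rootChord⁻ (node l r) a x y eq)))
  notLeft : triangulation l a x y ≡ false
  notLeft = ¬-not λ eq → let (_ , x<y , y≤) = triangulation-bounds l a x y eq in <⇒≱ (<-≤-trans x<y y≤) c≤x

SeparatingChord : Tree → Tree → ℕ → Set
SeparatingChord t t' a = ∃ λ x → ∃ λ y →
  a ≤ x × x < y × y ≤ a + leaves t × triangulation t a x y ≢ triangulation t' a x y

-- If the left subtree of t has fewer leaves than that of t', the root chord of the right subtree
-- of t crosses the root chord of the left subtree of t'.
apexChord-separates : ∀ l r l' r' a → leaves l < leaves l' → leaves (node l r) ≡ leaves (node l' r') →
  triangulation (node l r) a (a + leaves l) (a + leaves (node l r)) ≡ true ×
  triangulation (node l' r') a (a + leaves l) (a + leaves (node l r)) ≡ false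
apexChord-separates l r l' r' a l<l' same = inT , notInT'
  where
  inT : triangulation (node l r) a (a + leaves l) (a + leaves (node l r)) ≡ true
  inT = triangulation-right l r a _ _
          (subst (λ z → triangulation r (a + leaves l) (a + leaves l) z ≡ true) (sym (+-leaves a l r))
                 (triangulation-root r (a + leaves l)))
  notInT' : triangulation (node l' r') a (a + leaves l) (a + leaves (node l r)) ≡ false
  notInT' = ¬-not λ eq →
    triangulation-nonCrossing (node l' r') a a (a + leaves l') (a + leaves l) (a + leaves (node l r))
      (triangulation-left l' r' a _ _ (triangulation-root l' a)) eq
      (m<m+n a (1≤leaves l) , +-monoʳ-< a l<l' ,
       subst (a + leaves l' <_) (cong (a +_) (sym same))
             (subst (a + leaves l' <_) (sym (+-leaves a l' r')) (m<m+n _ (1≤leaves r'))))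

separatingChord : ∀ t t' a → leaves t ≡ leaves t' → t ≢ t' → SeparatingChord t t' a
separatingChord leaf leaf a _ t≢t' = ⊥-elim (t≢t' refl)
separatingChord leaf (node l r) a eq _ =
  ⊥-elim (<⇒≱ (+-mono-≤ (1≤leaves l) (1≤leaves r)) (≤-reflexive (sym eq)))
separatingChord (node l r) leaf a eq _ =
  ⊥-elim (<⇒≱ (+-mono-≤ (1≤leaves l) (1≤leaves r)) (≤-reflexive eq))
separatingChord (node l r) (node l' r') a same t≢t' with <-cmp (leaves l) (leaves l')
... | tri< l<l' _ _ =
  let (inT , notInT') = apexChord-separates l r l' r' a l<l' same in
  a + leaves l , a + leaves (node l r) , m≤m+n a (leaves l) ,
  +-monoʳ-< a (m<m+n (leaves l) (1≤leaves r)) , ≤-refl ,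
  λ eq → ≡true⇒≢false inT (trans eq notInT')
... | tri> _ _ l'<l =
  let (inT' , notInT) = apexChord-separates l' r' l r a l'<l (sym same) in
  a + leaves l' , a + leaves (node l' r') , m≤m+n a (leaves l') ,
  +-monoʳ-< a (m<m+n (leaves l') (1≤leaves r')) , ≤-reflexive (cong (a +_) (sym same)) ,
  λ eq → ≡true⇒≢false inT' (trans (sym eq) notInT)
... | tri≈ _ l≡l' _ with l ≟ᵀ l'
...   | no l≢l' =
  let (x , y , a≤x , x<y , y≤ , differ) = separatingChord l l' a l≡l' l≢l' in
  x , y , a≤x , x<y , ≤-trans y≤ (≤-trans (m≤m+n (a + leaves l) (leaves r)) (≤-reflexive (sym (+-leaves a l r)))) ,
  λ eq → differ (trans (sym (triangulation-inLeft l r a x y x<y y≤))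
                       (trans eq (triangulation-inLeft l' r' a x y x<y (subst (λ z → y ≤ a + z) l≡l' y≤))))
...   | yes refl =
  let (x , y , c≤x , x<y , y≤ , differ) =
        separatingChord r r' (a + leaves l) (+-cancelˡ-≡ (leaves l) _ _ same) (t≢t' ∘ cong (node l))
  in
  x , y , ≤-trans (m≤m+n a (leaves l)) c≤x , x<y , subst (y ≤_) (sym (+-leaves a l r)) y≤ ,
  λ eq → differ (trans (sym (triangulation-inRight l r a x y c≤x)) (trans eq (triangulation-inRight l r' a x y c≤x)))

-- Ballot and Catalan numbers

_C′_ : ℕ → ℕ → ℕ
n C′ zero  = 0
n C′ suc k = n C k

[1+n]Ck≡nC′k+nCk : ∀ n k → suc n C k ≡ n C′ k + n C k
[1+n]Ck≡nC′k+nCk n zero    = refl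
[1+n]Ck≡nC′k+nCk n (suc k) = sym (nCk+nC[k+1]≡[n+1]C[k+1] n k)

[1+k]*[1+n]C[1+k]≡[1+n]*nCk : ∀ n k → suc k * (suc n C suc k) ≡ suc n * (n C k)
[1+k]*[1+n]C[1+k]≡[1+n]*nCk zero    zero    = refl
[1+k]*[1+n]C[1+k]≡[1+n]*nCk zero    (suc k) = *-zeroʳ (2 + k)
[1+k]*[1+n]C[1+k]≡[1+n]*nCk (suc n) zero    =
  trans (+-identityʳ _) (trans (nC1≡n (2 + n)) (sym (*-identityʳ (2 + n))))
[1+k]*[1+n]C[1+k]≡[1+n]*nCk (suc n) (suc k) = begin
  (2 + k) * ((2 + n) C (2 + k))
    ≡⟨ cong ((2 + k) *_) (nCk+nC[k+1]≡[n+1]C[k+1] (suc n) (suc k)) ⟨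
  (2 + k) * (N C K + N C suc K)
    ≡⟨ *-distribˡ-+ (2 + k) (N C K) (N C suc K) ⟩
  (N C K + K * (N C K)) + suc K * (N C suc K)
    ≡⟨ cong₂ (λ u v → (N C K + u) + v) ([1+k]*[1+n]C[1+k]≡[1+n]*nCk n k) ([1+k]*[1+n]C[1+k]≡[1+n]*nCk n K) ⟩
  (N C K + N * (n C k)) + N * (n C K)
    ≡⟨ +-assoc (N C K) _ _ ⟩
  N C K + (N * (n C k) + N * (n C K))
    ≡⟨ cong (N C K +_) (*-distribˡ-+ N (n C k) (n C K)) ⟨
  N C K + N * (n C k + n C K)
    ≡⟨ cong (λ z → N C K + N * z) (nCk+nC[k+1]≡[n+1]C[k+1] n k) ⟩
  suc N * (N C K) ∎
  where
  open ≡-Reasoning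
  N = suc n
  K = suc k

[1+k]*nC[1+k]+[1+k]*nCk≡[1+n]*nCk : ∀ n k → suc k * (n C suc k) + suc k * (n C k) ≡ suc n * (n C k)
[1+k]*nC[1+k]+[1+k]*nCk≡[1+n]*nCk n k = begin
  suc k * (n C suc k) + suc k * (n C k)  ≡⟨ *-distribˡ-+ (suc k) (n C suc k) (n C k) ⟨
  suc k * (n C suc k + n C k)            ≡⟨ cong (suc k *_) (+-comm (n C suc k) (n C k)) ⟩
  suc k * (n C k + n C suc k)            ≡⟨ cong (suc k *_) (nCk+nC[k+1]≡[n+1]C[k+1] n k) ⟩
  suc k * (suc n C suc k)                ≡⟨ [1+k]*[1+n]C[1+k]≡[1+n]*nCk n k ⟩
  suc n * (n C k)                        ∎
  where open ≡-Reasoning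

central-absorption : ∀ q → (2 + q) * (2 * suc q C q) ≡ suc q * (2 * suc q C suc q)
central-absorption q = sym (+-cancelʳ-≡ (suc q * P) _ _ (begin
  suc q * X + suc q * P         ≡⟨ [1+k]*nC[1+k]+[1+k]*nCk≡[1+n]*nCk (2 * suc q) q ⟩
  suc (2 * suc q) * P           ≡⟨ split q P ⟩
  (2 + q) * P + suc q * P       ∎))
  where
  open ≡-Reasoning
  X = 2 * suc q C suc q
  P = 2 * suc q C q
  split : ∀ q P → suc (2 * suc q) * P ≡ (2 + q) * P + suc q * P
  split = solve-∀

ballot : ℕ → ℕ → ℕ
ballot zero    d       = 1
ballot (suc q) zero    = ballot q 1
ballot (suc q) (suc d) = ballot (suc q) d + ballot q (2 + d)

[2q+1]C[q+1]≡[2q+1]Cq : ∀ q → (2 * q + 1) C suc q ≡ (2 * q + 1) C q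
[2q+1]C[q+1]≡[2q+1]Cq q = subst (λ n → n C suc q ≡ n C q) (sym (2q+1≡q+[1+q] q))
  (trans (nCk≡nC[n∸k] (m≤n+m (suc q) q)) (cong ((q + suc q) C_) (m+n∸n≡m q (suc q))))
  where
  2q+1≡q+[1+q] : ∀ q → 2 * q + 1 ≡ q + suc q
  2q+1≡q+[1+q] = solve-∀

ballot-closedForm : ∀ q d → ballot q d + (2 * q + d) C′ q ≡ (2 * q + d) C q
ballot-closedForm zero    d    = refl
ballot-closedForm (suc q) zero = begin
  ballot q 1 + (2 * suc q + 0) C q
    ≡⟨ cong (λ z → ballot q 1 + z C q) (2[1+q]+0≡1+N q) ⟩
  ballot q 1 + suc N C q
    ≡⟨ cong (ballot q 1 +_) ([1+n]Ck≡nC′k+nCk N q) ⟩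
  ballot q 1 + (N C′ q + N C q)
    ≡⟨ +-assoc (ballot q 1) _ _ ⟨
  (ballot q 1 + N C′ q) + N C q
    ≡⟨ cong (_+ N C q) (ballot-closedForm q 1) ⟩
  N C q + N C q
    ≡⟨ cong (N C q +_) ([2q+1]C[q+1]≡[2q+1]Cq q) ⟨
  N C q + N C suc q
    ≡⟨ nCk+nC[k+1]≡[n+1]C[k+1] N q ⟩
  suc N C suc q
    ≡⟨ cong (_C suc q) (2[1+q]+0≡1+N q) ⟨
  (2 * suc q + 0) C suc q ∎
  where
  open ≡-Reasoning
  N = 2 * q + 1
  2[1+q]+0≡1+N : ∀ q → 2 * suc q + 0 ≡ suc (2 * q + 1)
  2[1+q]+0≡1+N = solve-∀
ballot-closedForm (suc q) (suc d) = begin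
  (B₁ + B₂) + (2 * suc q + suc d) C q
    ≡⟨ cong (λ z → (B₁ + B₂) + z C q) (2[1+q]+[1+d]≡1+N q d) ⟩
  (B₁ + B₂) + suc N C q
    ≡⟨ cong ((B₁ + B₂) +_) ([1+n]Ck≡nC′k+nCk N q) ⟩
  (B₁ + B₂) + (N C′ q + N C q)
    ≡⟨ regroup B₁ B₂ (N C′ q) (N C q) ⟩
  (B₂ + N C′ q) + (B₁ + N C q)
    ≡⟨ cong₂ _+_ (ballot-closedForm q (2 + d))
                 (subst (λ z → B₁ + z C q ≡ z C suc q) (2[1+q]+d≡N q d) (ballot-closedForm (suc q) d)) ⟩
  N C q + N C suc q
    ≡⟨ nCk+nC[k+1]≡[n+1]C[k+1] N q ⟩
  suc N C suc q
    ≡⟨ cong (_C suc q) (2[1+q]+[1+d]≡1+N q d) ⟨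
  (2 * suc q + suc d) C suc q ∎
  where
  open ≡-Reasoning
  N = 2 * q + (2 + d)
  B₁ = ballot (suc q) d
  B₂ = ballot q (2 + d)
  2[1+q]+[1+d]≡1+N : ∀ q d → 2 * suc q + suc d ≡ suc (2 * q + (2 + d))
  2[1+q]+[1+d]≡1+N = solve-∀
  2[1+q]+d≡N : ∀ q d → 2 * suc q + d ≡ 2 * q + (2 + d)
  2[1+q]+d≡N = solve-∀
  regroup : ∀ a b c e → (a + b) + (c + e) ≡ (b + c) + (a + e)
  regroup = solve-∀

-- With X = C(2Q, Q) and P = C(2Q, Q - 1): ballot Q 0 = X - P and (Q + 1) P = Q X,
-- hence (Q + 1) · ballot Q 0 = X.
catalan≡ballot : ∀ q → catalan (suc q) ≡ ballot (suc q) 0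
catalan≡ballot q = begin
  (X / suc Q)      ≡⟨ cong (_/ suc Q) B*[1+Q]≡X ⟨
  (B * suc Q) / suc Q ≡⟨ m*n/n≡m B (suc Q) ⟩
  B ∎
  where
  open ≡-Reasoning
  Q = suc q
  X = (2 * Q) C Q
  P = (2 * Q) C q
  B = ballot Q 0
  B+P≡X : B + P ≡ X
  B+P≡X = subst (λ z → B + z C q ≡ z C Q) (+-identityʳ (2 * Q)) (ballot-closedForm Q 0)
  B*[1+Q]≡X : B * suc Q ≡ X
  B*[1+Q]≡X = trans (*-comm B (suc Q)) (+-cancelʳ-≡ (Q * X) _ _ (begin
    suc Q * B + Q * X        ≡⟨ cong (suc Q * B +_) (central-absorption q) ⟨
    suc Q * B + suc Q * P    ≡⟨ *-distribˡ-+ (suc Q) B P ⟨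
    suc Q * (B + P)          ≡⟨ cong (suc Q *_) B+P≡X ⟩
    suc Q * X                ∎))

merge : ∀ {k} → Vec Tree (2 + k) → Vec Tree (1 + k)
merge (l ∷ r ∷ ts) = node l r ∷ ts

merge-injective : ∀ {k} {u v : Vec Tree (2 + k)} → merge u ≡ merge v → u ≡ v
merge-injective {u = _ ∷ _ ∷ _} {v = _ ∷ _ ∷ _} refl = refl

-- Forests of d + 1 trees with q internal nodes in total: either the first tree is a leaf,
-- or the forest arises by joining the first two trees of a forest of d + 2 trees.
forests : ℕ → (d : ℕ) → List (Vec Tree (suc d))
forests zero    d       = replicate (suc d) leaf ∷ []
forests (suc q) zero    = map merge (forests q 1)
forests (suc q) (suc d) = map (leaf ∷_) (forests (suc q) d) ++ map merge (forests q (2 + d))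

length-forests : ∀ q d → length (forests q d) ≡ ballot q d
length-forests zero    d       = refl
length-forests (suc q) zero    = trans (length-map merge (forests q 1)) (length-forests q 1)
length-forests (suc q) (suc d) = begin
  length (map (leaf ∷_) (forests (suc q) d) ++ map merge (forests q (2 + d)))
    ≡⟨ length-++ (map (leaf ∷_) (forests (suc q) d)) ⟩
  length (map (leaf ∷_) (forests (suc q) d)) + length (map merge (forests q (2 + d)))
    ≡⟨ cong₂ _+_ (length-map (leaf ∷_) (forests (suc q) d)) (length-map merge (forests q (2 + d))) ⟩
  length (forests (suc q) d) + length (forests q (2 + d))
    ≡⟨ cong₂ _+_ (length-forests (suc q) d) (length-forests q (2 + d)) ⟩
  ballot (suc q) (suc d) ∎
  where open ≡-Reasoning

forests-unique : ∀ q d → Unique (forests q d)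
forests-unique zero    d       = [] ∷ []
forests-unique (suc q) zero    = Unique.map⁺ merge-injective (forests-unique q 1)
forests-unique (suc q) (suc d) =
  Unique.++⁺ (Unique.map⁺ ∷-injectiveʳ (forests-unique (suc q) d))
             (Unique.map⁺ merge-injective (forests-unique q (2 + d)))
             λ (u∈ , v∈) → disjoint (∈-map⁻ (leaf ∷_) u∈) (∈-map⁻ merge v∈)
  where
  ∷-injectiveʳ : ∀ {k} {u v : Vec Tree k} → leaf ∷ u ≡ leaf ∷ v → u ≡ v
  ∷-injectiveʳ refl = refl
  disjoint : ∀ {k us ws} {v : Vec Tree (2 + k)} →
             ∃ (λ u → u ∈ˡ us × v ≡ leaf ∷ u) → ∃ (λ w → w ∈ˡ ws × v ≡ merge w) → ⊥
  disjoint (_ , _ , refl) ((_ ∷ _ ∷ _) , _ , ())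

totalLeaves : ∀ {k} → Vec Tree k → ℕ
totalLeaves []       = 0
totalLeaves (t ∷ ts) = leaves t + totalLeaves ts

merge-leaves : ∀ {k} (ts : Vec Tree (2 + k)) → totalLeaves (merge ts) ≡ totalLeaves ts
merge-leaves (l ∷ r ∷ ts) = +-assoc (leaves l) (leaves r) (totalLeaves ts)

forests-leaves : ∀ q d → All (λ ts → totalLeaves ts ≡ suc (q + d)) (forests q d)
forests-leaves zero    d       = replicateLeaves (suc d) ∷ []
  where
  replicateLeaves : ∀ d → totalLeaves (replicate d leaf) ≡ d
  replicateLeaves zero    = refl
  replicateLeaves (suc d) = cong suc (replicateLeaves d)
forests-leaves (suc q) zero    =
  All.map⁺ (All.map (λ {ts} eq → trans (merge-leaves ts) (trans eq (cong suc (+-suc q 0)))) (forests-leaves q 1))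
forests-leaves (suc q) (suc d) =
  All.++⁺ (All.map⁺ (All.map (λ eq → cong suc (trans eq (cong suc (sym (+-suc q d))))) (forests-leaves (suc q) d)))
          (All.map⁺ (All.map (λ {ts} eq → trans (merge-leaves ts) (trans eq (cong suc (+-suc q (suc d)))))
                             (forests-leaves q (2 + d))))

binaryTrees : ℕ → List Tree
binaryTrees q = map head (forests q 0)

length-binaryTrees : ∀ q → length (binaryTrees q) ≡ ballot q 0
length-binaryTrees q = trans (length-map head (forests q 0)) (length-forests q 0)

binaryTrees-unique : ∀ q → Unique (binaryTrees q)
binaryTrees-unique q = Unique.map⁺ head-injective (forests-unique q 0)
  where
  head-injective : ∀ {u v : Vec Tree 1} → head u ≡ head v → u ≡ v
  head-injective {_ ∷ []} {_ ∷ []} refl = refl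

binaryTrees-leaves : ∀ q → All (λ t → leaves t ≡ suc q) (binaryTrees q)
binaryTrees-leaves q = All.map⁺ (All.map (λ {ts} → leaves≡ {ts}) (forests-leaves q 0))
  where
  leaves≡ : ∀ {ts : Vec Tree 1} → totalLeaves ts ≡ suc (q + 0) → leaves (head ts) ≡ suc q
  leaves≡ {t ∷ []} eq = trans (sym (+-identityʳ (leaves t))) (trans eq (cong suc (+-identityʳ q)))

tabulateℕ : ∀ {n} → (ℕ → Bool) → Subset n
tabulateℕ {zero}  p = []
tabulateℕ {suc n} p = p 0 ∷ tabulateℕ (λ j → p (suc j))

lookupℕ : ∀ {n} → Subset n → ℕ → Bool
lookupℕ []      j       = false
lookupℕ (b ∷ S) zero    = b
lookupℕ (b ∷ S) (suc j) = lookupℕ S j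

lookupℕ-tabulateℕ : ∀ {n} p j → j < n → lookupℕ (tabulateℕ {n} p) j ≡ p j
lookupℕ-tabulateℕ {suc n} p zero    _         = refl
lookupℕ-tabulateℕ {suc n} p (suc j) (s<s j<n) = lookupℕ-tabulateℕ (λ j → p (suc j)) j j<n

lookupℕ-ext : ∀ {n} (S T : Subset n) → (∀ j → j < n → lookupℕ S j ≡ lookupℕ T j) → S ≡ T
lookupℕ-ext []      []      eq = refl
lookupℕ-ext (b ∷ S) (c ∷ T) eq =
  cong₂ _∷_ (eq 0 z<s) (lookupℕ-ext S T (λ j j<n → eq (suc j) (s<s j<n)))

lookupℕ⇒∈ : ∀ {n} (S : Subset n) (j : Fin n) → lookupℕ S (toℕ j) ≡ true → j ∈ S
lookupℕ⇒∈ (true ∷ S) Fin.zero    refl = here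
lookupℕ⇒∈ (b ∷ S)    (Fin.suc j) eq   = there (lookupℕ⇒∈ S j eq)

∈⇒lookupℕ : ∀ {n} (S : Subset n) (j : Fin n) → j ∈ S → lookupℕ S (toℕ j) ≡ true
∈⇒lookupℕ (true ∷ S) Fin.zero    here      = refl
∈⇒lookupℕ (b ∷ S)    (Fin.suc j) (there m) = ∈⇒lookupℕ S j m

∈-tabulateℕ⁻ : ∀ {n} p (j : Fin n) → j ∈ tabulateℕ p → p (toℕ j) ≡ true
∈-tabulateℕ⁻ p j j∈ = trans (sym (lookupℕ-tabulateℕ p (toℕ j) (toℕ<n j))) (∈⇒lookupℕ _ j j∈)

∈-tabulateℕ⁺ : ∀ {n} p (j : Fin n) → p (toℕ j) ≡ true → j ∈ tabulateℕ p
∈-tabulateℕ⁺ p j eq = lookupℕ⇒∈ _ j (trans (lookupℕ-tabulateℕ p (toℕ j) (toℕ<n j)) eq)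

tabulateℕ-cong : ∀ {n} p q → (∀ j → j < n → p j ≡ q j) → tabulateℕ {n} p ≡ tabulateℕ q
tabulateℕ-cong p q eq = lookupℕ-ext _ _ λ j j<n →
  trans (lookupℕ-tabulateℕ p j j<n) (trans (eq j j<n) (sym (lookupℕ-tabulateℕ q j j<n)))

empty : ∀ {n} → Subset n
empty = tabulateℕ λ _ → false

singleton : ∀ {n} → ℕ → Subset n
singleton y = tabulateℕ (_≡ᵇ y)

pair : ∀ {n} → ℕ → ℕ → Subset n
pair x y = tabulateℕ λ j → (j ≡ᵇ x) ∨ (j ≡ᵇ y)

pair-comm : ∀ {n} x y → pair {n} x y ≡ pair y x
pair-comm x y = tabulateℕ-cong _ _ λ j _ → ∨-comm (j ≡ᵇ x) (j ≡ᵇ y)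

∈-pair⁻ : ∀ {n} x y (j : Fin n) → j ∈ pair x y → toℕ j ≡ x ⊎ toℕ j ≡ y
∈-pair⁻ x y j j∈ with ∨-≡true⁻ (toℕ j ≡ᵇ x) (∈-tabulateℕ⁻ _ j j∈)
... | inj₁ eq = inj₁ (≡ᵇ-≡true⇒≡ _ _ eq)
... | inj₂ eq = inj₂ (≡ᵇ-≡true⇒≡ _ _ eq)

∈-pair⁺ : ∀ {n} x y (j : Fin n) → toℕ j ≡ x ⊎ toℕ j ≡ y → j ∈ pair x y
∈-pair⁺ x y j (inj₁ eq) = ∈-tabulateℕ⁺ _ j (∨-≡trueˡ _ (≡⇒≡ᵇ-≡true _ _ eq))
∈-pair⁺ x y j (inj₂ eq) = ∈-tabulateℕ⁺ _ j (∨-≡trueʳ _ (≡⇒≡ᵇ-≡true _ _ eq))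

∣empty∣≡0 : ∀ n → ∣ empty {n} ∣ ≡ 0
∣empty∣≡0 zero    = refl
∣empty∣≡0 (suc n) = ∣empty∣≡0 n

∣singleton∣≡1 : ∀ {n} y → y < n → ∣ singleton {n} y ∣ ≡ 1
∣singleton∣≡1 {suc n} zero    _         = cong suc (∣empty∣≡0 n)
∣singleton∣≡1 {suc n} (suc y) (s<s y<n) = ∣singleton∣≡1 y y<n

∣pair∣≡2 : ∀ {n} x y → x < y → y < n → ∣ pair {n} x y ∣ ≡ 2
∣pair∣≡2 {suc n} zero    (suc y) _         (s<s y<n) = cong suc (∣singleton∣≡1 y y<n)
∣pair∣≡2 {suc n} (suc x) (suc y) (s<s x<y) (s<s y<n) = ∣pair∣≡2 x y x<y y<n

∣pair∣≡2′ : ∀ {n} x y → x ≢ y → x < n → y < n → ∣ pair {n} x y ∣ ≡ 2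
∣pair∣≡2′ {n} x y x≢y x<n y<n with <-cmp x y
... | tri< x<y _ _ = ∣pair∣≡2 x y x<y y<n
... | tri≈ _ x≡y _ = ⊥-elim (x≢y x≡y)
... | tri> _ _ y<x = trans (cong ∣_∣ (pair-comm {n} x y)) (∣pair∣≡2 y x y<x x<n)

∣S∣≡0⇒S≡empty : ∀ {n} (S : Subset n) → ∣ S ∣ ≡ 0 → S ≡ empty
∣S∣≡0⇒S≡empty []          _  = refl
∣S∣≡0⇒S≡empty (false ∷ S) eq = cong (false ∷_) (∣S∣≡0⇒S≡empty S eq)

∣S∣≡1⇒S≡singleton : ∀ {n} (S : Subset n) → ∣ S ∣ ≡ 1 → ∃ λ y → y < n × S ≡ singleton y
∣S∣≡1⇒S≡singleton (true ∷ S)  eq = 0 , z<s , cong (true ∷_) (∣S∣≡0⇒S≡empty S (suc-injective eq))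
∣S∣≡1⇒S≡singleton (false ∷ S) eq with ∣S∣≡1⇒S≡singleton S eq
... | y , y<n , refl = suc y , s<s y<n , refl

∣S∣≡2⇒S≡pair : ∀ {n} (S : Subset n) → ∣ S ∣ ≡ 2 → ∃ λ x → ∃ λ y → x < y × y < n × S ≡ pair x y
∣S∣≡2⇒S≡pair (true ∷ S) eq with ∣S∣≡1⇒S≡singleton S (suc-injective eq)
... | y , y<n , refl = 0 , suc y , z<s , s<s y<n , refl
∣S∣≡2⇒S≡pair (false ∷ S) eq with ∣S∣≡2⇒S≡pair S eq
... | x , y , x<y , y<n , refl = suc x , suc y , s<s x<y , s<s y<n , refl

-- The two smallest elements of a subset (junk values past its end).
firstElement : ∀ {n} → Subset n → ℕ
firstElement []          = 0
firstElement (true ∷ S)  = 0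
firstElement (false ∷ S) = suc (firstElement S)

secondElement : ∀ {n} → Subset n → ℕ
secondElement []          = 0
secondElement (true ∷ S)  = suc (firstElement S)
secondElement (false ∷ S) = suc (secondElement S)

firstElement-singleton : ∀ {n} y → y < n → firstElement (singleton {n} y) ≡ y
firstElement-singleton {suc n} zero    _         = refl
firstElement-singleton {suc n} (suc y) (s<s y<n) = cong suc (firstElement-singleton y y<n)

elements-pair : ∀ {n} x y → x < y → y < n →
                firstElement (pair {n} x y) ≡ x × secondElement (pair {n} x y) ≡ y
elements-pair {suc n} zero    (suc y) _         (s<s y<n) = refl , cong suc (firstElement-singleton y y<n)
elements-pair {suc n} (suc x) (suc y) (s<s x<y) (s<s y<n) with elements-pair x y x<y y<n
... | eqx , eqy = cong suc eqx , cong suc eqy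

tally : ∀ {n} → (Subset n → Bool) → List (Subset n) → ℕ
tally V []       = 0
tally V (S ∷ Ss) = bit (V S) + tally V Ss

length-filter≡tally : ∀ {n} (V : Subset n → Bool) Ss → length (filter (λ S → V S ≟ᵇ true) Ss) ≡ tally V Ss
length-filter≡tally V []       = refl
length-filter≡tally V (S ∷ Ss) with V S
... | true  = cong suc (length-filter≡tally V Ss)
... | false = length-filter≡tally V Ss

tally-++ : ∀ {n} (V : Subset n → Bool) Ss Ts → tally V (Ss ++ Ts) ≡ tally V Ss + tally V Ts
tally-++ V []       Ts = refl
tally-++ V (S ∷ Ss) Ts = trans (cong (bit (V S) +_) (tally-++ V Ss Ts)) (sym (+-assoc (bit (V S)) _ _))

tally-map : ∀ {m n} (V : Subset n → Bool) (f : Subset m → Subset n) Ss → tally V (map f Ss) ≡ tally (λ S → V (f S)) Ss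
tally-map V f []       = refl
tally-map V f (S ∷ Ss) = cong (bit (V (f S)) +_) (tally-map V f Ss)

tally-none : ∀ {n} (V : Subset n → Bool) Ss → (∀ S → V S ≡ false) → tally V Ss ≡ 0
tally-none V []       none = refl
tally-none V (S ∷ Ss) none rewrite none S = tally-none V Ss none

tally-allSubsets : ∀ {n} (V : Subset (suc n) → Bool) → tally V (allSubsets (suc n)) ≡
  tally (λ S → V (true ∷ S)) (allSubsets n) + tally (λ S → V (false ∷ S)) (allSubsets n)
tally-allSubsets {n} V =
  trans (tally-++ V (map (true ∷_) (allSubsets n)) _)
        (cong₂ _+_ (tally-map V (true ∷_) (allSubsets n)) (tally-map V (false ∷_) (allSubsets n)))

SupportedOnSize : ∀ {n} → ℕ → (Subset n → Bool) → Set
SupportedOnSize k V = ∀ S → V S ≡ true → ∣ S ∣ ≡ k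

tally-size0 : ∀ n (V : Subset n → Bool) → SupportedOnSize 0 V → tally V (allSubsets n) ≡ bit (V empty)
tally-size0 zero    V _       = +-identityʳ _
tally-size0 (suc n) V support = trans (tally-allSubsets V) (cong₂ _+_
  (tally-none _ (allSubsets n) (λ S → ¬-not (λ eq → 1+n≢0 (support _ eq))))
  (tally-size0 n _ (λ S eq → support _ eq)))

-- Splitting on whether 0 ∈ S follows the recursion of count and countChords definitionally.
tally-size1 : ∀ n (V : Subset n → Bool) → SupportedOnSize 1 V →
              tally V (allSubsets n) ≡ count (λ y → V (singleton y)) n
tally-size1 zero    V support with V [] in eq
... | true  = ⊥-elim (0≢1+n (support [] eq))
... | false = refl
tally-size1 (suc n) V support = trans (tally-allSubsets V) (cong₂ _+_
  (tally-size0 n _ (λ S eq → suc-injective (support _ eq)))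
  (tally-size1 n _ (λ S eq → support _ eq)))

tally-size2 : ∀ n (V : Subset n → Bool) → SupportedOnSize 2 V →
              tally V (allSubsets n) ≡ countChords (λ x y → V (pair x y)) n
tally-size2 zero    V support with V [] in eq
... | true  = ⊥-elim (0≢1+n (support [] eq))
... | false = refl
tally-size2 (suc n) V support = trans (tally-allSubsets V) (cong₂ _+_
  (tally-size1 n _ (λ S eq → suc-injective (support _ eq)))
  (tally-size2 n _ (λ S eq → support _ eq)))

pair-injective : ∀ {n a b x y} → a ≢ b → a < n → b < n → pair {n} a b ≡ pair x y →
                 (a ≡ x × b ≡ y) ⊎ (a ≡ y × b ≡ x)
pair-injective {n} {a} {b} {x} {y} a≢b a<n b<n eq with member a<n (inj₁ refl) | member b<n (inj₂ refl)
  where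
  member : ∀ {z} → z < n → z ≡ a ⊎ z ≡ b → z ≡ x ⊎ z ≡ y
  member z<n z∈ = subst (λ v → v ≡ x ⊎ v ≡ y) (toℕ-fromℕ< z<n)
    (∈-pair⁻ x y _ (subst (fromℕ< z<n ∈_) eq
      (∈-pair⁺ a b _ (subst (λ v → v ≡ a ⊎ v ≡ b) (sym (toℕ-fromℕ< z<n)) z∈))))
... | inj₁ a≡x | inj₁ b≡x = ⊥-elim (a≢b (trans a≡x (sym b≡x)))
... | inj₁ a≡x | inj₂ b≡y = inj₁ (a≡x , b≡y)
... | inj₂ a≡y | inj₁ b≡x = inj₂ (a≡y , b≡x)
... | inj₂ a≡y | inj₂ b≡y = ⊥-elim (a≢b (trans a≡y (sym b≡y)))

x∈p─q⇒x∉q : ∀ {n} (p q : Subset n) {x} → x ∈ p ─ q → x ∉ q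
x∈p─q⇒x∉q (_ ∷ p) (true ∷ q) {Fin.zero}  ()         here
x∈p─q⇒x∉q (_ ∷ p) (_ ∷ q)    {Fin.suc x} (there x∈) (there x∈q) = x∈p─q⇒x∉q p q x∈ x∈q

WeaklySeparated-sym : ∀ {n} {I J : Subset n} → WeaklySeparated I J → WeaklySeparated J I
WeaklySeparated-sym ws alt = ws (swap alt)

∉-pair : ∀ {n} x y (j : Fin n) → toℕ j ≢ x → toℕ j ≢ y → j ∉ pair x y
∉-pair x y j j≢x j≢y j∈ with ∈-pair⁻ x y j j∈
... | inj₁ j≡x = j≢x j≡x
... | inj₂ j≡y = j≢y j≡y

∈-pair-∖-pair : ∀ {n v a b u w} (v<n : v < n) → v ≡ a ⊎ v ≡ b → v ≢ u → v ≢ w →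
                (pair a b , pair u w) ∖∋ fromℕ< v<n
∈-pair-∖-pair v<n v∈ v≢u v≢w =
  ∈-pair⁺ _ _ _ (subst (λ z → z ≡ _ ⊎ z ≡ _) (sym (toℕ-fromℕ< v<n)) v∈) ,
  ∉-pair _ _ _ (subst (_≢ _) (sym (toℕ-fromℕ< v<n)) v≢u) (subst (_≢ _) (sym (toℕ-fromℕ< v<n)) v≢w)

crossing⇒alternating : ∀ {n} c d x y → Crossing c d x y → y < n →
  Alternating ((pair {n} c d , pair x y) ∖∋_) ((pair x y , pair c d) ∖∋_)
crossing⇒alternating {n} c d x y (c<x , x<d , d<y) y<n =
  fromℕ< c<n , fromℕ< x<n , fromℕ< d<n , fromℕ< y<n ,
  ordered c<n x<n c<x , ordered x<n d<n x<d , ordered d<n y<n d<y ,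
  ∈-pair-∖-pair c<n (inj₁ refl) (<⇒≢ c<x) (<⇒≢ c<y) ,
  ∈-pair-∖-pair x<n (inj₁ refl) (>⇒≢ c<x) (<⇒≢ x<d) ,
  ∈-pair-∖-pair d<n (inj₂ refl) (>⇒≢ x<d) (<⇒≢ d<y) ,
  ∈-pair-∖-pair y<n (inj₂ refl) (>⇒≢ c<y) (>⇒≢ d<y)
  where
  d<n : d < n
  d<n = <-trans d<y y<n
  x<n : x < n
  x<n = <-trans x<d d<n
  c<n : c < n
  c<n = <-trans c<x x<n
  c<y : c < y
  c<y = <-trans c<x (<-trans x<d d<y)
  ordered : ∀ {u v} (u<n : u < n) (v<n : v < n) → u < v → fromℕ< u<n Fin.< fromℕ< v<n
  ordered u<n v<n u<v = subst₂ _<_ (sym (toℕ-fromℕ< u<n)) (sym (toℕ-fromℕ< v<n)) u<v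

crossing⇒¬WeaklySeparated : ∀ {n} c d x y → Crossing c d x y → y < n →
                            ¬ WeaklySeparated (pair {n} c d) (pair x y)
crossing⇒¬WeaklySeparated c d x y cr y<n ws = ws (inj₁ (crossing⇒alternating c d x y cr y<n))

ordered-members : ∀ {c d a e} → c < d → a ≡ c ⊎ a ≡ d → e ≡ c ⊎ e ≡ d → a < e → a ≡ c × e ≡ d
ordered-members c<d (inj₁ refl) (inj₁ refl) a<e = ⊥-elim (<-irrefl refl a<e)
ordered-members c<d (inj₁ refl) (inj₂ refl) a<e = refl , refl
ordered-members c<d (inj₂ refl) (inj₁ refl) a<e = ⊥-elim (<-asym c<d a<e)
ordered-members c<d (inj₂ refl) (inj₂ refl) a<e = ⊥-elim (<-irrefl refl a<e)

alternating⇒crossing : ∀ {n} c d x y → c < d → x < y →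
  Alternating ((pair {n} c d , pair x y) ∖∋_) ((pair x y , pair c d) ∖∋_) → Crossing c d x y
alternating⇒crossing c d x y c<d x<y
  (a , b , e , f , a<b , b<e , e<f , (a∈ , _) , (b∈ , _) , (e∈ , _) , (f∈ , _))
  with ordered-members c<d (∈-pair⁻ c d a a∈) (∈-pair⁻ c d e e∈) (<-trans a<b b<e)
     | ordered-members x<y (∈-pair⁻ x y b b∈) (∈-pair⁻ x y f f∈) (<-trans b<e e<f)
... | refl , refl | refl , refl = a<b , b<e , e<f

nonCrossing⇒WeaklySeparated : ∀ {n} c d x y → c < d → x < y → ¬ Crossing c d x y → ¬ Crossing x y c d →
                              WeaklySeparated (pair {n} c d) (pair x y)
nonCrossing⇒WeaklySeparated c d x y c<d x<y ¬cr ¬cr′ (inj₁ alt) = ¬cr (alternating⇒crossing c d x y c<d x<y alt)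
nonCrossing⇒WeaklySeparated c d x y c<d x<y ¬cr ¬cr′ (inj₂ alt) = ¬cr′ (alternating⇒crossing x y c d x<y c<d alt)

module _ {P : Pred ℕ 0ℓ} (P? : Decidable P) {u v n : ℕ} (u<v : u < v) (v<n : v < n)
         (only : ∀ r → r < n → P r → r ≡ u ⊎ r ≡ v) (Pu : P u) (Pv : P v) where

  private
    filter-upTo-suc : ∀ r → filter P? (upTo (suc r)) ≡ filter P? (upTo r) ++ filter P? (r ∷ [])
    filter-upTo-suc r = trans (cong (filter P?) (sym (upTo-∷ʳ r))) (filter-++ P? (upTo r) (r ∷ []))

    skip : ∀ {r} → r < n → r ≢ u → r ≢ v → filter P? (upTo (suc r)) ≡ filter P? (upTo r)
    skip {r} r<n r≢u r≢v = begin
      filter P? (upTo (suc r))                 ≡⟨ filter-upTo-suc r ⟩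
      filter P? (upTo r) ++ filter P? (r ∷ []) ≡⟨ cong (filter P? (upTo r) ++_) (filter-reject P? ¬Pr) ⟩
      filter P? (upTo r) ++ []                 ≡⟨ ++-identityʳ _ ⟩
      filter P? (upTo r)                       ∎
      where
      open ≡-Reasoning
      ¬Pr : ¬ P r
      ¬Pr Pr with only r r<n Pr
      ... | inj₁ r≡u = r≢u r≡u
      ... | inj₂ r≡v = r≢v r≡v

    keep : ∀ {r} → P r → filter P? (upTo (suc r)) ≡ filter P? (upTo r) ++ r ∷ []
    keep {r} Pr = trans (filter-upTo-suc r) (cong (filter P? (upTo r) ++_) (filter-accept P? Pr))

    u<n : u < n
    u<n = <-trans u<v v<n

    before-u : ∀ m → m ≤ u → filter P? (upTo m) ≡ []
    before-u zero    _   = refl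
    before-u (suc m) m<u = trans (skip (<-trans m<u u<n) (<⇒≢ m<u) (<⇒≢ (<-trans m<u u<v))) (before-u m (<⇒≤ m<u))

    before-v : ∀ m → u < m → m ≤ v → filter P? (upTo m) ≡ u ∷ []
    before-v (suc m) u<1+m m<v with m≤n⇒m<n∨m≡n (≤-pred u<1+m)
    ... | inj₂ refl = trans (keep Pu) (cong (_++ u ∷ []) (before-u u ≤-refl))
    ... | inj₁ u<m  = trans (skip (<-trans m<v v<n) (>⇒≢ u<m) (<⇒≢ m<v)) (before-v m u<m (<⇒≤ m<v))

    after-v : ∀ m → v < m → m ≤ n → filter P? (upTo m) ≡ u ∷ v ∷ []
    after-v (suc m) v<1+m m<n with m≤n⇒m<n∨m≡n (≤-pred v<1+m)
    ... | inj₂ refl = trans (keep Pv) (cong (_++ v ∷ []) (before-v v u<v ≤-refl))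
    ... | inj₁ v<m  = trans (skip m<n (>⇒≢ (<-trans u<v v<m)) (>⇒≢ v<m)) (after-v m v<m (<⇒≤ m<n))

  filter-upTo≡[u,v] : filter P? (upTo n) ≡ u ∷ v ∷ []
  filter-upTo≡[u,v] = after-v n v<n ≤-refl

module Rotation (m : ℕ) where

  n : ℕ
  n = suc m

  %-wrap : ∀ i r → i < n → r < n → (i + r) % n ≡ i + r ⊎ (i + r) % n + n ≡ i + r
  %-wrap i r i<n r<n with i + r <? n
  ... | yes i+r<n = inj₁ (m<n⇒m%n≡m i+r<n)
  ... | no  i+r≮n = inj₂ (begin
    (i + r) % n + n              ≡⟨ cong (λ z → z % n + n) (m∸n+n≡m n≤i+r) ⟨
    (i + r ∸ n + n) % n + n      ≡⟨ cong (_+ n) ([m+n]%n≡m%n (i + r ∸ n) n) ⟩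
    (i + r ∸ n) % n + n          ≡⟨ cong (_+ n) (m<n⇒m%n≡m i+r∸n<n) ⟩
    i + r ∸ n + n                ≡⟨ m∸n+n≡m n≤i+r ⟩
    i + r                        ∎)
    where
    open ≡-Reasoning
    n≤i+r : n ≤ i + r
    n≤i+r = ≮⇒≥ i+r≮n
    i+r∸n<n : i + r ∸ n < n
    i+r∸n<n = +-cancelʳ-< n (i + r ∸ n) n (subst (_< n + n) (sym (m∸n+n≡m n≤i+r)) (+-mono-< i<n r<n))

  wrapAround : ∀ i {X r r'} → X ≡ i + r → X + n ≡ i + r' → r' < n → ⊥
  wrapAround i {X} {r} {r'} a b r'<n = <⇒≱ r'<n (+-cancelˡ-≤ i n r'
    (≤-trans (+-monoˡ-≤ n (m≤m+n i r)) (≤-reflexive (trans (cong (_+ n) (sym a)) b))))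

  rotate-injective : ∀ i r r' → i < n → r < n → r' < n → (i + r) % n ≡ (i + r') % n → r ≡ r'
  rotate-injective i r r' i<n r<n r'<n eq with %-wrap i r i<n r<n | %-wrap i r' i<n r'<n
  ... | inj₁ a | inj₁ b = +-cancelˡ-≡ i r r' (trans (sym a) (trans eq b))
  ... | inj₂ a | inj₂ b = +-cancelˡ-≡ i r r' (trans (sym a) (trans (cong (_+ n) eq) b))
  ... | inj₁ a | inj₂ b = ⊥-elim (wrapAround i a (trans (cong (_+ n) eq) b) r'<n)
  ... | inj₂ a | inj₁ b = ⊥-elim (wrapAround i b (trans (cong (_+ n) (sym eq)) a) r<n)

  rotate-surjective : ∀ i x → i < n → x < n → ∃ λ u → u < n × (i + u) % n ≡ x
  rotate-surjective i x i<n x<n with i ≤? x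
  ... | yes i≤x = x ∸ i , ≤-<-trans (m∸n≤m x i) x<n , trans (cong (_% n) (m+[n∸m]≡n i≤x)) (m<n⇒m%n≡m x<n)
  ... | no  i≰x = n ∸ i + x , u<n , (begin
    (i + (n ∸ i + x)) % n  ≡⟨ cong (_% n) (+-assoc i (n ∸ i) x) ⟨
    (i + (n ∸ i) + x) % n  ≡⟨ cong (λ z → (z + x) % n) (m+[n∸m]≡n (<⇒≤ i<n)) ⟩
    (n + x) % n            ≡⟨ cong (_% n) (+-comm n x) ⟩
    (x + n) % n            ≡⟨ [m+n]%n≡m%n x n ⟩
    x % n                  ≡⟨ m<n⇒m%n≡m x<n ⟩
    x                      ∎)
    where
    open ≡-Reasoning
    u<n : n ∸ i + x < n
    u<n = subst (n ∸ i + x <_) (m∸n+n≡m (<⇒≤ i<n)) (+-monoʳ-< (n ∸ i) (≰⇒> i≰x))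

  toℕ-mod : ∀ a → toℕ (a mod n) ≡ a % n
  toℕ-mod a = toℕ-fromℕ< (m%n<n a n)

  shiftedKeys-pair-at : ∀ (i : Fin n) {x y u v} → u < v → v < n →
    (toℕ i + u) % n ≡ x → (toℕ i + v) % n ≡ y → shiftedKeys i (pair x y) ≡ u ∷ v ∷ []
  shiftedKeys-pair-at i {x} {y} {u} {v} u<v v<n eu ev =
    filter-upTo≡[u,v] (λ r → ((toℕ i + r) mod n) ∈? pair x y) u<v v<n only
      (∈-pair⁺ x y _ (inj₁ (trans (toℕ-mod (toℕ i + u)) eu)))
      (∈-pair⁺ x y _ (inj₂ (trans (toℕ-mod (toℕ i + v)) ev)))
    where
    position : ∀ {r w z} → r < n → w < n → toℕ ((toℕ i + r) mod n) ≡ z → (toℕ i + w) % n ≡ z → r ≡ w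
    position {r} r<n w<n er ew =
      rotate-injective (toℕ i) _ _ (toℕ<n i) r<n w<n (trans (sym (toℕ-mod (toℕ i + r))) (trans er (sym ew)))
    only : ∀ r → r < n → ((toℕ i + r) mod n) ∈ pair x y → r ≡ u ⊎ r ≡ v
    only r r<n r∈ with ∈-pair⁻ x y _ r∈
    ... | inj₁ er = inj₁ (position r<n (<-trans u<v v<n) er eu)
    ... | inj₂ er = inj₂ (position r<n v<n er ev)

  shiftedKeys-pair : ∀ (i : Fin n) x y → x ≢ y → x < n → y < n →
                     ∃ λ u → ∃ λ v → u < v × shiftedKeys i (pair x y) ≡ u ∷ v ∷ []
  shiftedKeys-pair i x y x≢y x<n y<n
    with rotate-surjective (toℕ i) x (toℕ<n i) x<n | rotate-surjective (toℕ i) y (toℕ<n i) y<n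
  ... | u , u<n , eu | v , v<n , ev with <-cmp u v
  ...   | tri< u<v _ _ = u , v , u<v , shiftedKeys-pair-at i u<v v<n eu ev
  ...   | tri≈ _ refl _ = ⊥-elim (x≢y (trans (sym eu) ev))
  ...   | tri> _ _ v<u =
    v , u , v<u , trans (cong (shiftedKeys i) (pair-comm x y)) (shiftedKeys-pair-at i v<u u<n ev eu)

-- The necklace of sides of the n-gon

module Polygon (k : ℕ) where

  m : ℕ
  m = 2 + k

  open Rotation m public

  toℕ-nextFin : ∀ (j : Fin n) → (suc (toℕ j) < n × toℕ (nextFin j) ≡ suc (toℕ j))
                               ⊎ (toℕ j ≡ m × toℕ (nextFin j) ≡ 0)
  toℕ-nextFin j with suc (toℕ j) <? n
  ... | yes 1+j<n = inj₁ (1+j<n , trans (toℕ-mod (suc (toℕ j))) (m<n⇒m%n≡m 1+j<n))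
  ... | no  1+j≮n = inj₂ (j≡m , trans (toℕ-mod (suc (toℕ j))) (trans (cong (λ z → suc z % n) j≡m) (n%n≡0 n)))
    where
    j≡m : toℕ j ≡ m
    j≡m = suc-injective (≤-antisym (toℕ<n j) (≮⇒≥ 1+j≮n))

  nextFin≢ : ∀ j → toℕ j ≢ toℕ (nextFin j)
  nextFin≢ j eq with toℕ-nextFin j
  ... | inj₁ (_ , e) = 1+n≢n (sym (trans eq e))
  ... | inj₂ (e₁ , e₂) = 1+n≢0 (trans (sym e₁) (trans eq e₂))

  side : Fin n → Subset n
  side j = pair (toℕ j) (toℕ (nextFin j))

  side-next : ∀ j → side (nextFin j) ≡ (side j - j) ∪ ⁅ nextFin (nextFin j) ⁆
  side-next j = ⊆-antisym ⊆ ⊇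
    where
    a = toℕ j
    b = toℕ (nextFin j)
    c = toℕ (nextFin (nextFin j))
    ⊆ : ∀ {z} → z ∈ side (nextFin j) → z ∈ (side j - j) ∪ ⁅ nextFin (nextFin j) ⁆
    ⊆ {z} z∈ with ∈-pair⁻ b c z z∈
    ... | inj₁ z≡b = x∈p∪q⁺ (inj₁ (x∈p∧x∉q⇒x∈p─q (∈-pair⁺ a b z (inj₂ z≡b))
                       λ z∈⁅j⁆ → nextFin≢ j (trans (sym (cong toℕ (x∈⁅y⁆⇒x≡y j z∈⁅j⁆))) z≡b)))
    ... | inj₂ z≡c = x∈p∪q⁺ (inj₂ (subst (_∈ ⁅ _ ⁆) (sym (toℕ-injective z≡c)) (x∈⁅x⁆ _)))
    ⊇ : ∀ {z} → z ∈ (side j - j) ∪ ⁅ nextFin (nextFin j) ⁆ → z ∈ side (nextFin j)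
    ⊇ {z} z∈ with x∈p∪q⁻ (side j - j) _ z∈
    ... | inj₂ z∈⁅c⁆ = ∈-pair⁺ b c z (inj₂ (cong toℕ (x∈⁅y⁆⇒x≡y _ z∈⁅c⁆)))
    ... | inj₁ z∈ with ∈-pair⁻ a b z (p─q⊆p (side j) ⁅ j ⁆ z∈)
    ...   | inj₂ z≡b = ∈-pair⁺ b c z (inj₁ z≡b)
    ...   | inj₁ z≡a = ⊥-elim (x∈p─q⇒x∉q (side j) ⁅ j ⁆ z∈ (subst (_∈ ⁅ j ⁆) (sym (toℕ-injective z≡a)) (x∈⁅x⁆ j)))

  necklace : GrassmannNecklace n 2
  necklace = record
    { I     = side
    ; size  = λ j → ∣pair∣≡2′ (toℕ j) (toℕ (nextFin j)) (nextFin≢ j) (toℕ<n j) (toℕ<n (nextFin j))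
    ; step∈ = λ j _ → nextFin (nextFin j) , side-next j
    ; step∉ = λ j j∉ → ⊥-elim (j∉ (∈-pair⁺ (toℕ j) (toℕ (nextFin j)) j (inj₁ refl)))
    }

  shiftedKeys-side : ∀ i → shiftedKeys i (side i) ≡ 0 ∷ 1 ∷ []
  shiftedKeys-side i = shiftedKeys-pair-at i z<s (s<s z<s)
    (trans (cong (_% n) (+-identityʳ (toℕ i))) (m<n⇒m%n≡m (toℕ<n i)))
    (trans (cong (_% n) (+-comm (toℕ i) 1)) (sym (toℕ-mod (suc (toℕ i)))))

  pair-inPositroid : ∀ x y → x ≢ y → x < n → y < n → InPositroid necklace (pair x y)
  pair-inPositroid x y x≢y x<n y<n = ∣pair∣≡2′ x y x≢y x<n y<n , gale
    where
    gale : ∀ i → GaleLeq i (side i) (pair x y)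
    gale i with shiftedKeys-pair i x y x≢y x<n y<n
    ... | u , v , u<v , eq rewrite shiftedKeys-side i | eq = z≤n ∷ ≤-trans z<s u<v ∷ []

  ∣S∣≡2⇒inPositroid : ∀ S → ∣ S ∣ ≡ 2 → InPositroid necklace S
  ∣S∣≡2⇒inPositroid S ∣S∣≡2 with ∣S∣≡2⇒S≡pair S ∣S∣≡2
  ... | x , y , x<y , y<n , refl = pair-inPositroid x y (<⇒≢ x<y) (<-trans x<y y<n) y<n

  module _ {S : Subset n} {r : ℕ} (rank : IsRank necklace S r) where

    rank≥1 : ∀ {s t : Fin n} → toℕ s ≢ toℕ t → s ∈ S → 1 ≤ r
    rank≥1 {s} {t} s≢t s∈S = ≤-trans (subst (_≤ ∣ pair (toℕ s) (toℕ t) ∩ S ∣) (∣⁅x⁆∣≡1 s) (p⊆q⇒∣p∣≤∣q∣ ⁅s⁆⊆))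
      (proj₂ rank _ (pair-inPositroid (toℕ s) (toℕ t) s≢t (toℕ<n s) (toℕ<n t)))
      where
      ⁅s⁆⊆ : ∀ {z} → z ∈ ⁅ s ⁆ → z ∈ pair (toℕ s) (toℕ t) ∩ S
      ⁅s⁆⊆ z∈ rewrite x∈⁅y⁆⇒x≡y s z∈ = x∈p∩q⁺ (∈-pair⁺ (toℕ s) (toℕ t) s (inj₁ refl) , s∈S)

    rank≥2 : ∀ {s w : Fin n} → toℕ s ≢ toℕ w → s ∈ S → w ∈ S → 2 ≤ r
    rank≥2 {s} {w} s≢w s∈S w∈S =
      ≤-trans (subst (_≤ ∣ pair (toℕ s) (toℕ w) ∩ S ∣) (∣pair∣≡2′ (toℕ s) (toℕ w) s≢w (toℕ<n s) (toℕ<n w))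
                       (p⊆q⇒∣p∣≤∣q∣ pair⊆))
              (proj₂ rank _ (pair-inPositroid (toℕ s) (toℕ w) s≢w (toℕ<n s) (toℕ<n w)))
      where
      pair⊆ : ∀ {z} → z ∈ pair (toℕ s) (toℕ w) → z ∈ pair (toℕ s) (toℕ w) ∩ S
      pair⊆ {z} z∈ with ∈-pair⁻ _ _ z z∈
      ... | inj₁ z≡s = x∈p∩q⁺ (z∈ , subst (_∈ S) (sym (toℕ-injective z≡s)) s∈S)
      ... | inj₂ z≡w = x∈p∩q⁺ (z∈ , subst (_∈ S) (sym (toℕ-injective z≡w)) w∈S)

  rank-⊤ : ∀ {r} → IsRank necklace ⊤ r → r ≡ 2
  rank-⊤ ((B , (∣B∣≡2 , _) , eq) , _) = trans (sym eq) (trans (cong ∣_∣ (∩-identityʳ B)) ∣B∣≡2)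

  thirdVertex : ∀ a b → ∃ λ w → w < 3 × w ≢ a × w ≢ b
  thirdVertex a b with 0 ≟ a | 0 ≟ b | 1 ≟ a | 1 ≟ b
  ... | no 0≢a | no 0≢b | _      | _      = 0 , z<s , 0≢a , 0≢b
  ... | yes refl | _    | _      | no 1≢b = 1 , s<s z<s , (λ ()) , 1≢b
  ... | yes refl | _    | _      | yes refl = 2 , ≤-refl , (λ ()) , (λ ())
  ... | no 0≢a | yes refl | no 1≢a | _    = 1 , s<s z<s , 1≢a , (λ ())
  ... | no 0≢a | yes refl | yes refl | _  = 2 , ≤-refl , (λ ()) , (λ ())

  -- Any proper nonempty S misses a vertex t and contains a vertex s; a third vertex w lies in S
  -- or in its complement, so the ranks of S and ∁ S add up to at least 3 > 2 = rank ⊤.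
  connected : Connected necklace
  connected (S , (s , s∈S) , (t , t∈∁S) , r₁ , r₂ , r , rank₁ , rank₂ , rank , r₁+r₂≡r) =
    <⇒≱ (subst (_< 3) (sym (trans r₁+r₂≡r (rank-⊤ rank))) ≤-refl) 3≤r₁+r₂
    where
    s≢t : toℕ s ≢ toℕ t
    s≢t eq = x∈∁p⇒x∉p t∈∁S (subst (_∈ S) (toℕ-injective eq) s∈S)
    w′ : ∃ λ w → w < 3 × w ≢ toℕ s × w ≢ toℕ t
    w′ = thirdVertex (toℕ s) (toℕ t)
    w : Fin n
    w = fromℕ< (≤-trans (proj₁ (proj₂ w′)) (s≤s (s≤s (s≤s z≤n))))
    w≢s : toℕ s ≢ toℕ w
    w≢s eq = proj₁ (proj₂ (proj₂ w′)) (trans (sym (toℕ-fromℕ< _)) (sym eq))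
    w≢t : toℕ t ≢ toℕ w
    w≢t eq = proj₂ (proj₂ (proj₂ w′)) (trans (sym (toℕ-fromℕ< _)) (sym eq))
    3≤r₁+r₂ : 3 ≤ r₁ + r₂
    3≤r₁+r₂ with w ∈? S
    ... | yes w∈S = +-mono-≤ (rank≥2 rank₁ w≢s s∈S w∈S) (rank≥1 rank₂ (s≢t ∘ sym) t∈∁S)
    ... | no  w∉S = subst (_≤ r₁ + r₂) (+-comm 1 2)
                      (+-mono-≤ (rank≥1 rank₁ s≢t s∈S) (rank≥2 rank₂ w≢t t∈∁S (x∉p⇒x∈∁p w∉S)))

  sideChord : Chords
  sideChord x y = (suc x ≡ᵇ y) ∨ ((x ≡ᵇ 0) ∧ (y ≡ᵇ m))

  isSide : Subset n → Bool
  isSide S = any (λ j → does (side j ≟S S)) (allFin n)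

  isSide⁻ : ∀ S → isSide S ≡ true → ∃ λ j → side j ≡ S
  isSide⁻ S eq with any-≡true⁻ (λ j → does (side j ≟S S)) (allFin n) eq
  ... | j , eqj = j , does-≡true⁻ (side j ≟S S) eqj

  isSide⁺ : ∀ j → isSide (side j) ≡ true
  isSide⁺ j = any-≡true⁺ (λ i → does (side i ≟S side j)) (allFin n) (∈-allFin j) (dec-true (side j ≟S side j) refl)

  isSide-size : SupportedOnSize 2 isSide
  isSide-size S eq with isSide⁻ S eq
  ... | j , refl = GrassmannNecklace.size necklace j

  isSide-pair : ∀ x y → x < y → y < n → isSide (pair x y) ≡ sideChord x y
  isSide-pair x y x<y y<n = ≡true⇔⇒≡ fromSide toSide
    where
    x<n : x < n
    x<n = <-trans x<y y<n
    fromSide : isSide (pair x y) ≡ true → sideChord x y ≡ true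
    fromSide eq with isSide⁻ (pair x y) eq
    ... | j , sidej≡ with pair-injective {x = x} {y = y} (nextFin≢ j) (toℕ<n j) (toℕ<n (nextFin j)) sidej≡ | toℕ-nextFin j
    ...   | inj₁ (refl , refl) | inj₁ (_ , e) = ∨-≡trueˡ _ (≡⇒≡ᵇ-≡true _ _ (sym e))
    ...   | inj₂ (refl , refl) | inj₁ (_ , e) = ⊥-elim (<-asym x<y (subst (toℕ j <_) (sym e) (n<1+n _)))
    ...   | inj₁ (refl , refl) | inj₂ (_ , e) = ⊥-elim (<⇒≱ x<y (subst (_≤ toℕ j) (sym e) z≤n))
    ...   | inj₂ (refl , refl) | inj₂ (e₁ , e₂) =
      ∨-≡trueʳ _ (subst₂ (λ u v → ((u ≡ᵇ 0) ∧ (v ≡ᵇ m)) ≡ true) (sym e₂) (sym e₁)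
                         (≡⇒≡ᵇ-≡true m m refl))
    toSide : sideChord x y ≡ true → isSide (pair x y) ≡ true
    toSide eq with ∨-≡true⁻ (suc x ≡ᵇ y) eq
    ... | inj₁ 1+x≡y with ≡ᵇ-≡true⇒≡ (suc x) y 1+x≡y | toℕ-nextFin (fromℕ< x<n)
    ...   | refl | inj₁ (_ , e) =
      subst (λ S → isSide S ≡ true) (cong₂ pair (toℕ-fromℕ< x<n) (trans e (cong suc (toℕ-fromℕ< x<n))))
            (isSide⁺ (fromℕ< x<n))
    ...   | refl | inj₂ (e , _) = ⊥-elim (<-irrefl (cong suc (trans (sym (toℕ-fromℕ< x<n)) e)) y<n)
    toSide eq | inj₂ x≡0∧y≡m with ∧-≡true⁻ (x ≡ᵇ 0) x≡0∧y≡m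
    ... | x≡0 , y≡m with ≡ᵇ-≡true⇒≡ x 0 x≡0 | ≡ᵇ-≡true⇒≡ y m y≡m | toℕ-nextFin (fromℕ< (n<1+n m))
    ...   | refl | refl | inj₁ (m+1<n , _) = ⊥-elim (<-irrefl (cong suc (toℕ-fromℕ< (n<1+n m))) m+1<n)
    ...   | refl | refl | inj₂ (_ , e) =
      subst (λ S → isSide S ≡ true) (trans (cong₂ pair (toℕ-fromℕ< (n<1+n m)) e) (pair-comm m 0))
            (isSide⁺ (fromℕ< (n<1+n m)))

  countChords-consecutive : ∀ p → countChords (λ x y → suc x ≡ᵇ y) (suc p) ≡ p
  countChords-consecutive zero    = refl
  countChords-consecutive (suc p) =
    cong suc (cong₂ _+_ (count-none p _ (λ _ _ → refl)) (countChords-consecutive p))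

  countChords-sideChord : countChords sideChord n ≡ n
  countChords-sideChord = cong₂ _+_ firstRow otherRows
    where
    firstRow : count (λ y → sideChord 0 (suc y)) m ≡ 2
    firstRow = cong suc (count-onlyLast k (_≡ᵇ k) (≡⇒≡ᵇ-≡true k k refl)
                                         (λ j j<k → ¬-not (<⇒≢ j<k ∘ ≡ᵇ-≡true⇒≡ j k)))
    otherRows : countChords (shift 1 sideChord) m ≡ suc k
    otherRows = trans (countChords-cong m (λ x y _ _ → ∨-identityʳ (suc x ≡ᵇ y))) (countChords-consecutive (suc k))

  necklaceCard≡n : necklaceCard necklace ≡ n
  necklaceCard≡n = begin
    necklaceCard necklace                    ≡⟨ length-filter≡tally isSide (allSubsets n) ⟩
    tally isSide (allSubsets n)              ≡⟨ tally-size2 n isSide isSide-size ⟩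
    countChords (λ x y → isSide (pair x y)) n ≡⟨ countChords-cong n isSide-pair ⟩
    countChords sideChord n                  ≡⟨ countChords-sideChord ⟩
    n                                        ∎
    where open ≡-Reasoning

-- Maximal weakly separated collections

module Triangulations (k : ℕ) where

  open Polygon k

  chordsOf : (Subset n → Bool) → Chords
  chordsOf V x y = V (pair x y)

  module _ {V : Subset n → Bool} (isMax : IsMaxWSC necklace V) where

    private
      inPositroid : ∀ S → V S ≡ true → InPositroid necklace S
      inPositroid = proj₁ isMax
      separated : ∀ S T → V S ≡ true → V T ≡ true → WeaklySeparated S T
      separated = proj₁ (proj₂ (proj₂ isMax))
      saturated : ∀ T → InPositroid necklace T → (∀ S → V S ≡ true → WeaklySeparated S T) → V T ≡ true
      saturated = proj₂ (proj₂ (proj₂ isMax))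

    IsMaxWSC⇒NonCrossing : NonCrossing (chordsOf V) m
    IsMaxWSC⇒NonCrossing x y x' y' _ y'≤m e e' cr =
      crossing⇒¬WeaklySeparated x y x' y' cr (s≤s y'≤m) (separated _ _ e e')

    IsMaxWSC⇒Maximal : Maximal (chordsOf V) m
    IsMaxWSC⇒Maximal x y x<y y≤m none =
      saturated (pair x y) (pair-inPositroid x y (<⇒≢ x<y) (<-trans x<y (s≤s y≤m)) (s≤s y≤m)) separatedFrom
      where
      separatedFrom : ∀ S → V S ≡ true → WeaklySeparated S (pair x y)
      separatedFrom S S∈V with ∣S∣≡2⇒S≡pair S (proj₁ (inPositroid S S∈V))
      ... | c , d , c<d , d<n , refl with none c d c<d (≤-pred d<n) S∈V
      ...   | ¬xy×cd , ¬cd×xy = nonCrossing⇒WeaklySeparated c d x y c<d x<y ¬cd×xy ¬xy×cd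

    IsMaxWSC-card : card necklace V ≡ necklaceCard necklace + k
    IsMaxWSC-card = begin
      card necklace V                  ≡⟨ length-filter≡tally V (allSubsets n) ⟩
      tally V (allSubsets n)           ≡⟨ tally-size2 n V (λ S S∈V → proj₁ (inPositroid S S∈V)) ⟩
      countChords (chordsOf V) n       ≡⟨ +-cancelʳ-≡ 1 _ _ (trans triangulated (2m≡n+k+1 k)) ⟩
      n + k                            ≡⟨ cong (_+ k) necklaceCard≡n ⟨
      necklaceCard necklace + k        ∎
      where
      open ≡-Reasoning
      triangulated : countChords (chordsOf V) n + 1 ≡ 2 * m
      triangulated = countChords-maximal m z<s (chordsOf V) IsMaxWSC⇒NonCrossing IsMaxWSC⇒Maximal
      2m≡n+k+1 : ∀ k → 2 * (2 + k) ≡ 3 + k + k + 1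
      2m≡n+k+1 = solve-∀

  interiorSize : HasInteriorSize necklace k
  interiorSize V isMax = IsMaxWSC-card isMax

  collection : Tree → Subset n → Bool
  collection t S = (∣ S ∣ ≡ᵇ 2) ∧ triangulation t 0 (firstElement S) (secondElement S)

  collection-pair : ∀ t x y → x < y → y < n → collection t (pair x y) ≡ triangulation t 0 x y
  collection-pair t x y x<y y<n
    rewrite ∣pair∣≡2 {n} x y x<y y<n | proj₁ (elements-pair {n} x y x<y y<n) | proj₂ (elements-pair {n} x y x<y y<n)
    = refl

  collection-size : ∀ t → SupportedOnSize 2 (collection t)
  collection-size t S eq = ≡ᵇ-≡true⇒≡ _ 2 (proj₁ (∧-≡true⁻ (∣ S ∣ ≡ᵇ 2) eq))

  module _ (t : Tree) (leaves≡m : leaves t ≡ m) where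

    private
      y≤leaves : ∀ {y} → y < n → y ≤ 0 + leaves t
      y≤leaves y<n = subst (_ ≤_) (sym leaves≡m) (≤-pred y<n)
      y<n : ∀ {y} → y ≤ 0 + leaves t → y < n
      y<n y≤ = s≤s (subst (_ ≤_) leaves≡m y≤)

    collection-sides : ∀ j → collection t (side j) ≡ true
    collection-sides j with toℕ-nextFin j
    ... | inj₁ (1+j<n , eq) rewrite eq =
      trans (collection-pair t _ _ (n<1+n _) 1+j<n)
            (triangulation-side t 0 (toℕ j) z≤n (subst (toℕ j <_) (sym leaves≡m) (≤-pred 1+j<n)))
    ... | inj₂ (j≡m , eq) rewrite j≡m | eq =
      trans (cong (collection t) (pair-comm m 0))
            (trans (collection-pair t 0 m z<s ≤-refl)
                   (subst (λ z → triangulation t 0 0 z ≡ true) leaves≡m (triangulation-root t 0)))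

    collection-separated : ∀ S T → collection t S ≡ true → collection t T ≡ true → WeaklySeparated S T
    collection-separated S T S∈ T∈
      with ∣S∣≡2⇒S≡pair S (collection-size t S S∈) | ∣S∣≡2⇒S≡pair T (collection-size t T T∈)
    ... | c , d , c<d , d<n , refl | x , y , x<y , y<n′ , refl =
      nonCrossing⇒WeaklySeparated c d x y c<d x<y
        (triangulation-nonCrossing t 0 c d x y cd∈ xy∈) (triangulation-nonCrossing t 0 x y c d xy∈ cd∈)
      where
      cd∈ : triangulation t 0 c d ≡ true
      cd∈ = trans (sym (collection-pair t c d c<d d<n)) S∈
      xy∈ : triangulation t 0 x y ≡ true
      xy∈ = trans (sym (collection-pair t x y x<y y<n′)) T∈

    collection-saturated : ∀ T → InPositroid necklace T →
      (∀ S → collection t S ≡ true → WeaklySeparated S T) → collection t T ≡ true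
    collection-saturated T (∣T∣≡2 , _) sep with ∣S∣≡2⇒S≡pair T ∣T∣≡2
    ... | x , y , x<y , y<n′ , refl =
      trans (collection-pair t x y x<y y<n′) (triangulation-maximal t 0 x y z≤n x<y (y≤leaves y<n′) none)
      where
      none : ∀ x' y' → triangulation t 0 x' y' ≡ true → ¬ Crossing x y x' y' × ¬ Crossing x' y' x y
      none x' y' e with triangulation-bounds t 0 x' y' e
      ... | _ , x'<y' , y'≤ =
        (λ cr → crossing⇒¬WeaklySeparated x y x' y' cr (y<n y'≤) (WeaklySeparated-sym ws)) ,
        (λ cr → crossing⇒¬WeaklySeparated x' y' x y cr y<n′ ws)
        where
        ws : WeaklySeparated (pair x' y') (pair x y)
        ws = sep (pair x' y') (trans (collection-pair t x' y' x'<y' (y<n y'≤)) e)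

    collection-isMax : IsMaxWSC necklace (collection t)
    collection-isMax =
      (λ S eq → ∣S∣≡2⇒inPositroid S (collection-size t S eq)) ,
      collection-sides , collection-separated , collection-saturated

  collection-separates : ∀ t t' → leaves t ≡ m → leaves t' ≡ m → t ≢ t' → ∃ λ S → collection t S ≢ collection t' S
  collection-separates t t' lt lt' t≢t' with separatingChord t t' 0 (trans lt (sym lt')) t≢t'
  ... | x , y , _ , x<y , y≤ , differ = pair x y , λ eq →
    differ (trans (sym (collection-pair t x y x<y y<n)) (trans eq (collection-pair t' x y x<y y<n)))
    where
    y<n : y < n
    y<n = s≤s (subst (y ≤_) lt y≤)

  order : OrderAtLeast necklace (catalan (suc k))
  order = map collection trees , length≡ ,
          All.map⁺ (All.map (λ {t} → collection-isMax t) (binaryTrees-leaves (suc k))) ,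
          allPairs-map collection (λ lt lt' → collection-separates _ _ lt lt')
                       (binaryTrees-leaves (suc k)) (binaryTrees-unique (suc k))
    where
    trees : List Tree
    trees = binaryTrees (suc k)
    length≡ : length (map collection trees) ≡ catalan (suc k)
    length≡ = trans (length-map collection trees) (trans (length-binaryTrees (suc k)) (sym (catalan≡ballot k)))

proposition6p1 : (i : ℕ) → MLowerBound i (catalan (suc i))
proposition6p1 i = 3 + i , 2 , necklace , connected , interiorSize , order
  where
  open Polygon i
  open Triangulations i
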